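{- For $k\ge1$, writing $S_k(t)=\sum_{j=0}^{k-1}C_jt^j$, $$Q_{132}^{(0,0,k,0)}(t,x)=\frac{1+(tx-t)S_k(t)-\sqrt{(1+(tx-t)S_k(t))^2-4tx}}{2tx}=\frac{2}{1+(tx-t)S_k(t)+\sqrt{(1+(tx-t)S_k(t))^2-4tx}},$$ and $$Q_{132}^{(0,0,k,0)}(t,0)=\frac{1}{1-t(C_0+C_1t+\cdots+C_{k-1}t^{k-1})}.$$
   Context: For $\sigma=\sigma_1\cdots\sigma_n\in S_n$, $\mathrm{mmp}^{(0,0,k,0)}(\sigma)$ is the number of positions $i$ such that there are at least $k$ indices $j<i$ with $\sigma_j<\sigma_i$. $S_n(132)$ is the set of 132-avoiding permutations of $[n]$. $Q_{n,132}^{(0,0,k,0)}(x)=\sum_{\sigma\in S_n(132)}x^{\mathrm{mmp}^{(0,0,k,0)}(\sigma)}$, $Q_{132}^{(0,0,k,0)}(t,x)=1+\sum_{n\ge1}t^nQ_{n,132}^{(0,0,k,0)}(x)$ as a formal power series in $t$; square roots are the formal power series in $t$ with constant term $1$. $C_n=\frac{1}{n+1}\binom{2n}{n}$. -}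

module Defs where

open import Data.Bool using (Bool; true; false; not; _∧_; _∨_; if_then_else_)
open import Data.Nat as ℕ using (ℕ; zero; suc; _∸_; _<ᵇ_; _≤ᵇ_; _≡ᵇ_)
open import Data.Nat.Combinatorics using (_C_)
open import Data.Nat.DivMod using (_/_)
open import Data.List using (List; []; _∷_; [_]; _++_; map; concatMap; upTo; length; filter)
open import Data.Bool.ListAction using (any)
open import Data.Integer as ℤ using (ℤ; +_)
open import Relation.Binary.PropositionalEquality using (_≡_)
open import Relation.Nullary.Decidable using (T?)

-- A permutation of length n is represented as a
-- word over {0,…,n-1} of length n with pairwise distinct letters
-- (one-line notation shifted down by 1; pattern containment and mmp only
-- depend on relative order).

words : ℕ → ℕ → List (List ℕ)
words zero    k = [ [] ]
words (suc n) k = concatMap (λ w → map (λ a → a ∷ w) (upTo k)) (words n k)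

elem : ℕ → List ℕ → Bool
elem a []      = false
elem a (b ∷ w) = (a ≡ᵇ b) ∨ elem a w

distinct : List ℕ → Bool
distinct []      = true
distinct (a ∷ w) = not (elem a w) ∧ distinct w

has21above : ℕ → List ℕ → Bool
has21above a []      = false
has21above a (b ∷ r) = any (λ c → (a <ᵇ c) ∧ (c <ᵇ b)) r ∨ has21above a r

contains132 : List ℕ → Bool
contains132 []      = false
contains132 (a ∷ r) = has21above a r ∨ contains132 r

count : (ℕ → Bool) → List ℕ → ℕ
count p []      = zero
count p (a ∷ w) = (if p a then 1 else 0) ℕ.+ count p w

-- mmpAux k prefix w : number of positions of w whose letter has at least k
-- smaller letters strictly to its left (the left part being prefix ++ …)
mmpAux : ℕ → List ℕ → List ℕ → ℕ
mmpAux k pre []      = zero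
mmpAux k pre (b ∷ r) =
  (if k ≤ᵇ count (λ a → a <ᵇ b) pre then 1 else 0) ℕ.+ mmpAux k (pre ++ [ b ]) r

mmp : ℕ → List ℕ → ℕ
mmp k w = mmpAux k [] w

qcount : ℕ → ℕ → ℕ → ℕ
qcount k n m =
  length (filter (λ w → T? (distinct w ∧ not (contains132 w) ∧ (mmp k w ≡ᵇ m))) (words n n))

-- Formal power series in t and x with integer coefficients:
-- F n m = coefficient of t^n x^m.

Series : Set
Series = ℕ → ℕ → ℤ

infix 4 _≈_
_≈_ : Series → Series → Set
F ≈ G = ∀ n m → F n m ≡ G n m

sumTo : ℕ → (ℕ → ℤ) → ℤ
sumTo zero    f = f zero
sumTo (suc n) f = sumTo n f ℤ.+ f (suc n)

infixl 6 _⊕_ _⊖_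
infixl 7 _⊗_

_⊕_ _⊖_ _⊗_ : Series → Series → Series
(F ⊕ G) n m = F n m ℤ.+ G n m
(F ⊖ G) n m = F n m ℤ.- G n m
(F ⊗ G) n m = sumTo n (λ i → sumTo m (λ j → F i j ℤ.* G (n ∸ i) (m ∸ j)))

cst : ℤ → Series
cst c zero zero = c
cst c _    _    = + 0

tS : Series
tS (suc zero) zero = + 1
tS _ _ = + 0

xS : Series
xS zero (suc zero) = + 1
xS _ _ = + 0

catalan : ℕ → ℕ
catalan j = ((2 ℕ.* j) C j) / suc j

Sk : ℕ → Series
Sk k n zero    = if n <ᵇ k then + catalan n else + 0
Sk k n (suc m) = + 0

Q : ℕ → Series
Q k n m = + qcount k n m

Q0 : ℕ → Series
Q0 k n zero    = Q k n zero
Q0 k n (suc m) = + 0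

Nk : ℕ → Series
Nk k = cst (+ 1) ⊕ (tS ⊗ xS ⊖ tS) ⊗ Sk k

Dk : ℕ → Series
Dk k = Nk k ⊗ Nk k ⊖ cst (+ 4) ⊗ tS ⊗ xS

-- Let Q = Q_{132}^{(0,0,k,0)}(t,x), S = Σ_{j<k} C_j t^j, N = 1 + (tx - t) S.
-- A 132-avoiding σ = u n v splits around its maximum n: u lies above v, both
-- avoid 132, and mmp(σ) = mmp(u) + [k ≤ |u|] + mmp(v) (MaximumDecomposition,
-- built on BoolFacts, NatSums, WordStatistics).  Summing over |u| gives a
-- recurrence for the coefficients of Q (DecompositionRecurrence).  Blocks of
-- length < k have no mmp, so their counts obey the Catalan recurrence and are
-- the coefficients of S (Catalan); the recurrence thus becomes the functional
-- equation Q = 1 + tSQ + tx(Q - S)Q, i.e. QN = 1 + txQ² (FunctionalEquation).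
-- The rest is power-series algebra (PowerSeries, QuadraticSolution):
-- G = N - 2txQ has G(0,0) = 1, G² = N² - 4tx and Q(N + G) = 2, the two closed
-- forms with G the square root; the x⁰-part gives Q(t,0)(1 - tS) = 1.

module Submission where

module BoolFacts where

  open import Data.Bool using (Bool; true; false; not; _∧_; _∨_; if_then_else_; T)
  open import Data.Nat using (ℕ; zero; suc; _*_; _≤_; _<_; _<ᵇ_; _≤ᵇ_; _≡ᵇ_; z≤n; s≤s)
  open import Data.Nat.Properties
    using (+-identityʳ; <⇒<ᵇ; <ᵇ⇒<; ≤⇒≤ᵇ; ≤ᵇ⇒≤; ≡⇒≡ᵇ; ≡ᵇ⇒≡; <⇒≱; ≮⇒≥)
  open import Data.Bool.Properties using (T-≡; T-not-≡; T-∧)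
  open import Data.Product using (_,_; proj₁; proj₂)
  open import Function.Bundles using (module Equivalence)
  open import Data.Unit using (tt)
  open import Data.Empty using (⊥; ⊥-elim)
  open import Relation.Binary.PropositionalEquality using (_≡_; refl; sym; subst)

  ι : Bool → ℕ
  ι true  = 1
  ι false = 0

  ι∧ : ∀ a b → ι (a ∧ b) ≡ ι a * ι b
  ι∧ true  b = sym (+-identityʳ (ι b))
  ι∧ false b = refl

  ι-if : ∀ b → (if b then 1 else 0) ≡ ι b
  ι-if true  = refl
  ι-if false = refl

  ι≤1 : ∀ b → ι b ≤ 1
  ι≤1 true  = s≤s z≤n
  ι≤1 false = z≤n

  T⇒≡true : ∀ {b} → T b → b ≡ true
  T⇒≡true = Equivalence.to T-≡

  ¬T⇒≡false : ∀ {b} → (T b → ⊥) → b ≡ false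
  ¬T⇒≡false {true}  f = ⊥-elim (f tt)
  ¬T⇒≡false {false} f = refl

  T-ext : ∀ {a b} → (T a → T b) → (T b → T a) → a ≡ b
  T-ext {true}  {true}  f g = refl
  T-ext {true}  {false} f g = ⊥-elim (f tt)
  T-ext {false} {true}  f g = ⊥-elim (g tt)
  T-ext {false} {false} f g = refl

  <ᵇ-true : ∀ {a b} → a < b → (a <ᵇ b) ≡ true
  <ᵇ-true p = T⇒≡true (<⇒<ᵇ p)

  <ᵇ-false : ∀ {a b} → b ≤ a → (a <ᵇ b) ≡ false
  <ᵇ-false {a} {b} p = ¬T⇒≡false (λ t → <⇒≱ (<ᵇ⇒< a b t) p)

  <ᵇ-false⁻¹ : ∀ {a c} → (a <ᵇ c) ≡ false → c ≤ a
  <ᵇ-false⁻¹ {a} {c} e = ≮⇒≥ (λ lt → subst T e (<⇒<ᵇ lt))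

  ≤ᵇ-true : ∀ {a b} → a ≤ b → (a ≤ᵇ b) ≡ true
  ≤ᵇ-true p = T⇒≡true (≤⇒≤ᵇ p)

  ≤ᵇ-false : ∀ {a b} → b < a → (a ≤ᵇ b) ≡ false
  ≤ᵇ-false {a} {b} p = ¬T⇒≡false (λ t → <⇒≱ p (≤ᵇ⇒≤ a b t))

  ≡ᵇ-true : ∀ {a b} → a ≡ b → (a ≡ᵇ b) ≡ true
  ≡ᵇ-true {a} {b} p = T⇒≡true (≡⇒≡ᵇ a b p)

  ≡ᵇ-false : ∀ {a b} → (a ≡ b → ⊥) → (a ≡ᵇ b) ≡ false
  ≡ᵇ-false {a} {b} p = ¬T⇒≡false (λ t → p (≡ᵇ⇒≡ a b t))

  ≡ᵇ-sym : ∀ a b → (a ≡ᵇ b) ≡ (b ≡ᵇ a)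
  ≡ᵇ-sym zero    zero    = refl
  ≡ᵇ-sym zero    (suc b) = refl
  ≡ᵇ-sym (suc a) zero    = refl
  ≡ᵇ-sym (suc a) (suc b) = ≡ᵇ-sym a b

  ∧-l : ∀ {a b} → T (a ∧ b) → T a
  ∧-l t = proj₁ (Equivalence.to T-∧ t)

  ∧-r : ∀ {a b} → T (a ∧ b) → T b
  ∧-r t = proj₂ (Equivalence.to T-∧ t)

  ∧-i : ∀ {a b} → T a → T b → T (a ∧ b)
  ∧-i p q = Equivalence.from T-∧ (p , q)

  ∨-l : ∀ {a b} → T (not (a ∨ b)) → T (not a)
  ∨-l {false} t = tt

  ∨-r : ∀ {a b} → T (not (a ∨ b)) → T (not b)
  ∨-r {false} t = t

  ∨-i : ∀ {a b} → T (not a) → T (not b) → T (not (a ∨ b))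
  ∨-i {false} _ t = t

  not-T : ∀ {a} → T (not a) → a ≡ false
  not-T = Equivalence.to T-not-≡

  T-not : ∀ {a} → a ≡ false → T (not a)
  T-not = Equivalence.from T-not-≡

module NatSums where

  open import Defs using (words)
  open BoolFacts
  open import Data.Bool using (Bool; true; false; _∧_)
  open import Data.Bool.Properties using (∧-zeroʳ)
  open import Data.Nat using (ℕ; zero; suc; _∸_; _+_; _*_; _≤_; _<_; _<ᵇ_; _≤ᵇ_; _≡ᵇ_)
  open import Data.Nat.Properties
  open import Data.Nat.Tactic.RingSolver using (solve-∀)
  open import Data.Nat.ListAction using (sum)
  open import Data.Nat.ListAction.Properties using (sum-++)
  open import Data.List using (List; []; _∷_; [_]; _++_; map; concatMap; upTo; length; filter)
  open import Data.List.Properties using (map-++; upTo-∷ʳ)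
  open import Relation.Binary.PropositionalEquality hiding ([_])
  open import Relation.Binary.Definitions using (tri<; tri≈; tri>)
  open import Relation.Nullary.Decidable using (T?)
  open import Data.List.Relation.Unary.All using (All; []; _∷_)

  ssum : ℕ → (ℕ → ℕ) → ℕ
  ssum zero    g = 0
  ssum (suc N) g = ssum N g + g N

  ssum-cong : ∀ N {f g} → (∀ a → a < N → f a ≡ g a) → ssum N f ≡ ssum N g
  ssum-cong zero    e = refl
  ssum-cong (suc N) e = cong₂ _+_ (ssum-cong N (λ a p → e a (m≤n⇒m≤1+n p))) (e N ≤-refl)

  ssum-+ : ∀ N f g → ssum N (λ x → f x + g x) ≡ ssum N f + ssum N g
  ssum-+ zero    f g = refl
  ssum-+ (suc N) f g rewrite ssum-+ N f g = interchange (ssum N f) (ssum N g) (f N) (g N)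
    where
    interchange : ∀ a b c d → a + b + (c + d) ≡ a + c + (b + d)
    interchange = solve-∀

  ssum-* : ∀ N c f → ssum N (λ x → c * f x) ≡ c * ssum N f
  ssum-* zero    c f = sym (*-zeroʳ c)
  ssum-* (suc N) c f rewrite ssum-* N c f = sym (*-distribˡ-+ c (ssum N f) (f N))

  ssum-0 : ∀ N {f} → (∀ a → a < N → f a ≡ 0) → ssum N f ≡ 0
  ssum-0 zero    e = refl
  ssum-0 (suc N) e rewrite ssum-0 N (λ a p → e a (m≤n⇒m≤1+n p)) = e N ≤-refl

  ssum-first : ∀ N f → ssum (suc N) f ≡ f 0 + ssum N (λ i → f (suc i))
  ssum-first zero    f = sym (+-identityʳ (f 0))
  ssum-first (suc N) f rewrite ssum-first N f = +-assoc (f 0) _ _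

  ssum-split : ∀ a b f → ssum (a + b) f ≡ ssum a f + ssum b (λ i → f (a + i))
  ssum-split a zero    f rewrite +-identityʳ a = sym (+-identityʳ _)
  ssum-split a (suc b) f rewrite +-suc a b | ssum-split a b f = +-assoc (ssum a f) _ _

  ssum-rev : ∀ n f → ssum (suc n) f ≡ ssum (suc n) (λ i → f (n ∸ i))
  ssum-rev zero    f = refl
  ssum-rev (suc n) f = begin
      ssum (suc n) f + f (suc n)
    ≡⟨ cong (_+ f (suc n)) (ssum-rev n f) ⟩
      ssum (suc n) (λ i → f (n ∸ i)) + f (suc n)
    ≡⟨ +-comm _ (f (suc n)) ⟩
      f (suc n) + ssum (suc n) (λ i → f (n ∸ i))
    ≡⟨ sym (ssum-first (suc n) (λ i → f (suc n ∸ i))) ⟩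
      ssum (suc (suc n)) (λ i → f (suc n ∸ i))
    ∎
    where open ≡-Reasoning

  ssum-≤1 : ∀ N f → (∀ x → f x ≤ 1) → ssum N f ≤ N
  ssum-≤1 zero    f p = ≤-refl
  ssum-≤1 (suc N) f p = subst (ssum N f + f N ≤_) (+-comm N 1) (+-mono-≤ (ssum-≤1 N f p) (p N))

  ssum-delta : ∀ M a (g : ℕ → ℕ) → ssum M (λ x → ι (x ≡ᵇ a) * g x) ≡ ι (a <ᵇ M) * g a
  ssum-delta zero    a g = refl
  ssum-delta (suc M) a g with <-cmp a M
  ... | tri< lt _ _ rewrite ssum-delta M a g | <ᵇ-true lt | <ᵇ-true (m<n⇒m<1+n lt)
                          | ≡ᵇ-false {M} {a} (λ e → <-irrefl (sym e) lt) = +-identityʳ _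
  ... | tri≈ _ refl _ rewrite ssum-delta M a g | <ᵇ-false (≤-refl {a}) | <ᵇ-true (n<1+n a)
                            | ≡ᵇ-true (refl {x = a}) = refl
  ... | tri> _ _ gt rewrite ssum-delta M a g | <ᵇ-false (<⇒≤ gt) | <ᵇ-false gt
                          | ≡ᵇ-false {M} {a} (λ e → <-irrefl e gt) = refl

  inA : ℕ → ℕ → ℕ → Bool
  inA s M a = (s ≤ᵇ a) ∧ (a <ᵇ s + M)

  ssum-window : ∀ s M N → s + M ≤ N → ∀ (g : ℕ → ℕ) →
    ssum N (λ a → ι (inA s M a) * g a) ≡ ssum M (λ b → g (s + b))
  ssum-window s M N le g = begin
      ssum N h
    ≡⟨ cong (λ z → ssum z h) (sym (m+[n∸m]≡n le)) ⟩
      ssum ((s + M) + (N ∸ (s + M))) h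
    ≡⟨ ssum-split (s + M) (N ∸ (s + M)) h ⟩
      ssum (s + M) h + ssum (N ∸ (s + M)) (λ i → h (s + M + i))
    ≡⟨ cong₂ _+_ (ssum-split s M h) (ssum-0 (N ∸ (s + M)) (λ i _ → above i)) ⟩
      ssum s h + ssum M (λ b → h (s + b)) + 0
    ≡⟨ +-identityʳ (ssum s h + ssum M (λ b → h (s + b))) ⟩
      ssum s h + ssum M (λ b → h (s + b))
    ≡⟨ cong₂ _+_ (ssum-0 s below) (ssum-cong M inside) ⟩
      ssum M (λ b → g (s + b))
    ∎
    where
    open ≡-Reasoning
    h : ℕ → ℕ
    h a = ι (inA s M a) * g a
    below : ∀ a → a < s → h a ≡ 0
    below a p rewrite ≤ᵇ-false p = refl
    above : ∀ i → h (s + M + i) ≡ 0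
    above i rewrite <ᵇ-false {s + M + i} {s + M} (m≤m+n (s + M) i)
                  | ∧-zeroʳ (s ≤ᵇ s + M + i) = refl
    inside : ∀ b → b < M → h (s + b) ≡ g (s + b)
    inside b p rewrite ≤ᵇ-true (m≤m+n s b) | <ᵇ-true (+-monoʳ-< s p) = +-identityʳ (g (s + b))

  Σl : ∀ {A : Set} → List A → (A → ℕ) → ℕ
  Σl xs f = sum (map f xs)

  Σl-++ : ∀ {A : Set} (xs ys : List A) f → Σl (xs ++ ys) f ≡ Σl xs f + Σl ys f
  Σl-++ xs ys f = trans (cong sum (map-++ f xs ys)) (sum-++ (map f xs) (map f ys))

  Σl-cong : ∀ {A : Set} (xs : List A) {f g} → (∀ x → f x ≡ g x) → Σl xs f ≡ Σl xs g
  Σl-cong []       e = refl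
  Σl-cong (x ∷ xs) e = cong₂ _+_ (e x) (Σl-cong xs e)

  Σl-+ : ∀ {A : Set} (xs : List A) f g → Σl xs (λ x → f x + g x) ≡ Σl xs f + Σl xs g
  Σl-+ []       f g = refl
  Σl-+ (x ∷ xs) f g rewrite Σl-+ xs f g = interchange (f x) (g x) (Σl xs f) (Σl xs g)
    where
    interchange : ∀ a b c d → a + b + (c + d) ≡ a + c + (b + d)
    interchange = solve-∀

  Σl-* : ∀ {A : Set} (xs : List A) c f → Σl xs (λ x → c * f x) ≡ c * Σl xs f
  Σl-* []       c f = sym (*-zeroʳ c)
  Σl-* (x ∷ xs) c f rewrite Σl-* xs c f = sym (*-distribˡ-+ c (f x) (Σl xs f))

  Σl-0 : ∀ {A : Set} (xs : List A) → Σl xs (λ _ → 0) ≡ 0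
  Σl-0 []       = refl
  Σl-0 (x ∷ xs) = Σl-0 xs

  Σl-map : ∀ {A B : Set} (xs : List A) (h : A → B) f → Σl (map h xs) f ≡ Σl xs (λ x → f (h x))
  Σl-map []       h f = refl
  Σl-map (x ∷ xs) h f = cong (f (h x) +_) (Σl-map xs h f)

  Σl-upTo : ∀ N g → Σl (upTo N) g ≡ ssum N g
  Σl-upTo zero    g = refl
  Σl-upTo (suc N) g = begin
      Σl (upTo (suc N)) g
    ≡⟨ cong (λ l → Σl l g) (sym (upTo-∷ʳ N)) ⟩
      Σl (upTo N ++ [ N ]) g
    ≡⟨ Σl-++ (upTo N) [ N ] g ⟩
      Σl (upTo N) g + (g N + 0)
    ≡⟨ cong₂ _+_ (Σl-upTo N g) (+-identityʳ (g N)) ⟩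
      ssum N g + g N
    ∎
    where open ≡-Reasoning

  Σl-ssum : ∀ {A : Set} (xs : List A) M (g : ℕ → A → ℕ) →
    Σl xs (λ x → ssum M (λ i → g i x)) ≡ ssum M (λ i → Σl xs (g i))
  Σl-ssum xs zero    g = Σl-0 xs
  Σl-ssum xs (suc M) g = trans (Σl-+ xs (λ x → ssum M (λ i → g i x)) (g M))
                               (cong (_+ Σl xs (g M)) (Σl-ssum xs M g))

  length-filter : ∀ {A : Set} (p : A → Bool) xs →
    length (filter (λ w → T? (p w)) xs) ≡ Σl xs (λ w → ι (p w))
  length-filter p []       = refl
  length-filter p (x ∷ xs) with p x
  ... | true  = cong suc (length-filter p xs)
  ... | false = length-filter p xs

  Σw : ℕ → ℕ → (List ℕ → ℕ) → ℕ
  Σw n N f = Σl (words n N) f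

  data IsWord (N : ℕ) : ℕ → List ℕ → Set where
    []  : IsWord N 0 []
    _∷_ : ∀ {a n w} → a < N → IsWord N n w → IsWord N (suc n) (a ∷ w)

  IsWord-length : ∀ {N n w} → IsWord N n w → length w ≡ n
  IsWord-length []       = refl
  IsWord-length (_ ∷ wd) = cong suc (IsWord-length wd)

  IsWord-letters : ∀ {N n w} → IsWord N n w → All (_< N) w
  IsWord-letters []       = []
  IsWord-letters (p ∷ wd) = p ∷ IsWord-letters wd

  Σw-suc : ∀ n N f → Σw (suc n) N f ≡ Σw n N (λ w → ssum N (λ a → f (a ∷ w)))
  Σw-suc n N f = trans (go (words n N)) (Σl-cong (words n N) (λ w → Σl-upTo N (λ a → f (a ∷ w))))
    where
    go : ∀ ws → Σl (concatMap (λ w → map (λ a → a ∷ w) (upTo N)) ws) f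
              ≡ Σl ws (λ w → Σl (upTo N) (λ a → f (a ∷ w)))
    go []       = refl
    go (w ∷ ws) = trans (Σl-++ (map (λ a → a ∷ w) (upTo N)) _ f)
                        (cong₂ _+_ (Σl-map (upTo N) (λ a → a ∷ w) f) (go ws))

  Σw-cong : ∀ n N {f g} → (∀ w → IsWord N n w → f w ≡ g w) → Σw n N f ≡ Σw n N g
  Σw-cong zero    N e = cong (_+ 0) (e [] [])
  Σw-cong (suc n) N {f} {g} e =
    trans (Σw-suc n N f)
          (trans (Σw-cong n N (λ w wd → ssum-cong N (λ a a<N → e (a ∷ w) (a<N ∷ wd))))
                 (sym (Σw-suc n N g)))

  Σw-++ : ∀ i j N f → Σw (i + j) N f ≡ Σw j N (λ v → Σw i N (λ u → f (u ++ v)))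
  Σw-++ zero    j N f = Σl-cong (words j N) (λ v → sym (+-identityʳ (f v)))
  Σw-++ (suc i) j N f = begin
      Σw (suc (i + j)) N f
    ≡⟨ Σw-suc (i + j) N f ⟩
      Σw (i + j) N (λ w → ssum N (λ a → f (a ∷ w)))
    ≡⟨ Σw-++ i j N (λ w → ssum N (λ a → f (a ∷ w))) ⟩
      Σw j N (λ v → Σw i N (λ u → ssum N (λ a → f (a ∷ (u ++ v)))))
    ≡⟨ Σl-cong (words j N) (λ v → sym (Σw-suc i N (λ u → f (u ++ v)))) ⟩
      Σw j N (λ v → Σw (suc i) N (λ u → f (u ++ v)))
    ∎
    where open ≡-Reasoning

  allB : (ℕ → Bool) → List ℕ → Bool
  allB p []      = true
  allB p (a ∷ w) = p a ∧ allB p w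

  Σw-window : ∀ n N s M → s + M ≤ N → ∀ (f : List ℕ → ℕ) →
    Σw n N (λ u → ι (allB (inA s M) u) * f u) ≡ Σw n M (λ u → f (map (s +_) u))
  Σw-window zero    N s M le f = cong (_+ 0) (+-identityʳ (f []))
  Σw-window (suc n) N s M le f = begin
      Σw (suc n) N (λ u → ι (allB (inA s M) u) * f u)
    ≡⟨ Σw-suc n N _ ⟩
      Σw n N (λ w → ssum N (λ a → ι (inA s M a ∧ allB (inA s M) w) * f (a ∷ w)))
    ≡⟨ Σl-cong (words n N) (λ w → trans (ssum-cong N (λ a _ → factor w a))
                                        (ssum-* N (ι (allB (inA s M) w)) _)) ⟩
      Σw n N (λ w → ι (allB (inA s M) w) * ssum N (λ a → ι (inA s M a) * f (a ∷ w)))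
    ≡⟨ Σw-window n N s M le (λ w → ssum N (λ a → ι (inA s M a) * f (a ∷ w))) ⟩
      Σw n M (λ w → ssum N (λ a → ι (inA s M a) * f (a ∷ map (s +_) w)))
    ≡⟨ Σl-cong (words n M) (λ w → ssum-window s M N le (λ a → f (a ∷ map (s +_) w))) ⟩
      Σw n M (λ w → ssum M (λ b → f (s + b ∷ map (s +_) w)))
    ≡⟨ sym (Σw-suc n M (λ u → f (map (s +_) u))) ⟩
      Σw (suc n) M (λ u → f (map (s +_) u))
    ∎
    where
    open ≡-Reasoning
    rearrange : ∀ x y z → (x * y) * z ≡ y * (x * z)
    rearrange = solve-∀
    factor : ∀ w a → ι (inA s M a ∧ allB (inA s M) w) * f (a ∷ w)
                   ≡ ι (allB (inA s M) w) * (ι (inA s M a) * f (a ∷ w))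
    factor w a rewrite ι∧ (inA s M a) (allB (inA s M) w) =
      rearrange (ι (inA s M a)) (ι (allB (inA s M) w)) (f (a ∷ w))

module WordStatistics where

  open import Defs
  open BoolFacts
  open NatSums using (ssum; ssum-0; ssum-+; ssum-cong; ssum-split; ssum-delta; ssum-≤1)
  open import Data.Bool using (Bool; true; false; not; _∧_; _∨_; if_then_else_; T)
  open import Data.Bool.Properties using (∧-zeroʳ; ∧-identityʳ; ∨-identityʳ; ∨-assoc)
  open import Data.Bool.ListAction using (any)
  open import Data.Nat using (ℕ; zero; suc; _∸_; _+_; _*_; _≤_; _<_; _<ᵇ_; _≤ᵇ_; _≡ᵇ_; z≤n; s≤s)
  open import Data.Nat.Properties
  open import Data.List using (List; []; _∷_; [_]; _++_; map; length)
  open import Data.List.Properties using (++-assoc; ++-identityʳ; length-++; map-++)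
  open import Data.List.Relation.Unary.All as All using (All; []; _∷_)
  open import Relation.Binary.PropositionalEquality hiding ([_])
  open import Data.Empty using (⊥)
  open import Data.Unit using (tt)
  open import Data.Product using (_×_; _,_; proj₁; proj₂)
  open import Data.Sum using (inj₁; inj₂)

  -- Shifting every letter by s preserves relative order, hence all statistics.

  sh : ℕ → List ℕ → List ℕ
  sh s = map (s +_)

  ≡ᵇ-sh : ∀ s a b → (s + a ≡ᵇ s + b) ≡ (a ≡ᵇ b)
  ≡ᵇ-sh zero    a b = refl
  ≡ᵇ-sh (suc s) a b = ≡ᵇ-sh s a b

  <ᵇ-sh : ∀ s a b → (s + a <ᵇ s + b) ≡ (a <ᵇ b)
  <ᵇ-sh zero    a b = refl
  <ᵇ-sh (suc s) a b = <ᵇ-sh s a b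

  elem-sh : ∀ s a w → elem (s + a) (sh s w) ≡ elem a w
  elem-sh s a []      = refl
  elem-sh s a (b ∷ w) = cong₂ _∨_ (≡ᵇ-sh s a b) (elem-sh s a w)

  distinct-sh : ∀ s w → distinct (sh s w) ≡ distinct w
  distinct-sh s []      = refl
  distinct-sh s (a ∷ w) = cong₂ (λ x y → not x ∧ y) (elem-sh s a w) (distinct-sh s w)

  has21above-sh : ∀ s a w → has21above (s + a) (sh s w) ≡ has21above a w
  has21above-sh s a []      = refl
  has21above-sh s a (b ∷ w) = cong₂ _∨_ (any-sh w) (has21above-sh s a w)
    where
    any-sh : ∀ w → any (λ c → (s + a <ᵇ c) ∧ (c <ᵇ s + b)) (sh s w)
                 ≡ any (λ c → (a <ᵇ c) ∧ (c <ᵇ b)) w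
    any-sh []      = refl
    any-sh (c ∷ w) = cong₂ _∨_ (cong₂ _∧_ (<ᵇ-sh s a c) (<ᵇ-sh s c b)) (any-sh w)

  contains132-sh : ∀ s w → contains132 (sh s w) ≡ contains132 w
  contains132-sh s []      = refl
  contains132-sh s (a ∷ w) = cong₂ _∨_ (has21above-sh s a w) (contains132-sh s w)

  count-sh : ∀ s b p → count (λ a → a <ᵇ s + b) (sh s p) ≡ count (λ a → a <ᵇ b) p
  count-sh s b []      = refl
  count-sh s b (a ∷ p) rewrite <ᵇ-sh s a b | count-sh s b p = refl

  mmpAux-sh : ∀ k s p w → mmpAux k (sh s p) (sh s w) ≡ mmpAux k p w
  mmpAux-sh k s p []      = refl
  mmpAux-sh k s p (b ∷ w) rewrite count-sh s b p =
    cong (_ +_) (trans (cong (λ q → mmpAux k q (sh s w)) (sym (map-++ (s +_) p [ b ])))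
                       (mmpAux-sh k s (p ++ [ b ]) w))

  mmp-sh : ∀ k s w → mmp k (sh s w) ≡ mmp k w
  mmp-sh k s w = mmpAux-sh k s [] w

  elem-++ : ∀ a u w → elem a (u ++ w) ≡ elem a u ∨ elem a w
  elem-++ a []      w = refl
  elem-++ a (b ∷ u) w rewrite elem-++ a u w = sym (∨-assoc (a ≡ᵇ b) (elem a u) (elem a w))

  elem-none : ∀ a w → All (λ b → (a ≡ b → ⊥)) w → elem a w ≡ false
  elem-none a []      []       = refl
  elem-none a (b ∷ w) (p ∷ ps) rewrite ≡ᵇ-false p = elem-none a w ps

  elem-none⁻¹ : ∀ a w → T (not (elem a w)) → All (λ b → (a ≡ b → ⊥)) w
  elem-none⁻¹ a []      t = []
  elem-none⁻¹ a (b ∷ w) t =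
    (λ e → subst (λ z → T (not z)) (≡ᵇ-true e) (∨-l {a ≡ᵇ b} t)) ∷ elem-none⁻¹ a w (∨-r {a ≡ᵇ b} t)

  distinct-split : ∀ u w → T (distinct (u ++ w)) →
    T (distinct u) × T (distinct w) × All (λ a → T (not (elem a w))) u
  distinct-split []      w t = tt , t , []
  distinct-split (a ∷ u) w t with distinct-split u w (∧-r t)
  ... | du , dw , dj rewrite elem-++ a u w =
    ∧-i (∨-l {elem a u} (∧-l t)) du , dw , ∨-r {elem a u} (∧-l t) ∷ dj

  distinct-join : ∀ u w → T (distinct u) → T (distinct w) →
    All (λ a → T (not (elem a w))) u → T (distinct (u ++ w))
  distinct-join []      w du dw []       = dw
  distinct-join (a ∷ u) w du dw (p ∷ ps) rewrite elem-++ a u w =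
    ∧-i (∨-i (∧-l du) p) (distinct-join u w (∧-r du) dw ps)

  -- 132-containment of u ++ n ∷ v when n is larger than everything else and
  -- every letter of u is at least every letter of v: no occurrence can use n
  -- or straddle the two blocks.

  any-++ : ∀ (p : ℕ → Bool) u w → any p (u ++ w) ≡ any p u ∨ any p w
  any-++ p []      w = refl
  any-++ p (b ∷ u) w rewrite any-++ p u w = sym (∨-assoc (p b) (any p u) (any p w))

  any-none : ∀ (p : ℕ → Bool) w → All (λ c → p c ≡ false) w → any p w ≡ false
  any-none p []      []       = refl
  any-none p (c ∷ w) (e ∷ es) rewrite e = any-none p w es

  any-none⁻¹ : ∀ (p : ℕ → Bool) w → T (not (any p w)) → All (λ c → p c ≡ false) w
  any-none⁻¹ p []      t = []
  any-none⁻¹ p (c ∷ w) t = not-T (∨-l {p c} t) ∷ any-none⁻¹ p w (∨-r {p c} t)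

  between-none : ∀ a b w → All (λ c → c ≤ a) w → any (λ c → (a <ᵇ c) ∧ (c <ᵇ b)) w ≡ false
  between-none a b w ps = any-none _ w (All.map (λ {c} q → cong (_∧ (c <ᵇ b)) (<ᵇ-false q)) ps)

  has21above-dominated : ∀ a r → All (λ b → b ≤ a) r → has21above a r ≡ false
  has21above-dominated a []      []       = refl
  has21above-dominated a (b ∷ r) (p ∷ ps)
    rewrite between-none a b r ps = has21above-dominated a r ps

  has21above-max : ∀ a n u v → a < n → All (_< n) u → All (λ b → b ≤ a) v →
    has21above a (u ++ n ∷ v) ≡ has21above a u
  has21above-max a n [] v an [] pv
    rewrite between-none a n v pv = has21above-dominated a v pv
  has21above-max a n (b ∷ u) v an (bn ∷ pu) pv
    rewrite any-++ (λ c → (a <ᵇ c) ∧ (c <ᵇ b)) u (n ∷ v)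
          | <ᵇ-false {n} {b} (<⇒≤ bn)
          | ∧-zeroʳ (a <ᵇ n)
          | between-none a b v pv
          | ∨-identityʳ (any (λ c → (a <ᵇ c) ∧ (c <ᵇ b)) u)
          | has21above-max a n u v an pu pv = refl

  contains132-max : ∀ n u v → All (λ a → All (λ b → b ≤ a) v × a < n) u → All (λ b → b ≤ n) v →
    contains132 (u ++ n ∷ v) ≡ contains132 u ∨ contains132 v
  contains132-max n []      v []              pv rewrite has21above-dominated n v pv = refl
  contains132-max n (a ∷ u) v ((pa , an) ∷ pu) pv
    rewrite has21above-max a n u v an (All.map proj₂ pu) pa | contains132-max n u v pu pv =
    sym (∨-assoc (has21above a u) (contains132 u) (contains132 v))

  has21above-++ʳ : ∀ a u r → T (not (has21above a (u ++ r))) → T (not (has21above a r))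
  has21above-++ʳ a []      r t = t
  has21above-++ʳ a (b ∷ u) r t =
    has21above-++ʳ a u r (∨-r {any (λ c → (a <ᵇ c) ∧ (c <ᵇ b)) (u ++ r)} t)

  -- in a 132-avoiding u ++ n ∷ v with n above v, every letter of u
  -- dominates every letter of v (a < b in that order would form a 132 with n)
  avoid132-max : ∀ n u v → All (_< n) v → T (not (contains132 (u ++ n ∷ v))) →
    All (λ a → All (λ b → b ≤ a) v) u
  avoid132-max n []      v pv t = []
  avoid132-max n (a ∷ u) v pv t =
    dominated v pv (any-none⁻¹ _ v (∨-l {any (λ c → (a <ᵇ c) ∧ (c <ᵇ n)) v}
                     (has21above-++ʳ a u (n ∷ v) (∨-l {has21above a (u ++ n ∷ v)} t))))
    ∷ avoid132-max n u v pv (∨-r {has21above a (u ++ n ∷ v)} t)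
    where
    dominated : ∀ w → All (_< n) w → All (λ c → ((a <ᵇ c) ∧ (c <ᵇ n)) ≡ false) w →
      All (λ b → b ≤ a) w
    dominated []      []        []       = []
    dominated (c ∷ w) (cn ∷ ps) (e ∷ es) rewrite <ᵇ-true cn | ∧-identityʳ (a <ᵇ c) =
      <ᵇ-false⁻¹ e ∷ dominated w ps es

  count-++ : ∀ (q : ℕ → Bool) x y → count q (x ++ y) ≡ count q x + count q y
  count-++ q []      y = refl
  count-++ q (a ∷ x) y rewrite count-++ q x y =
    sym (+-assoc (if q a then 1 else 0) (count q x) (count q y))

  count-all : ∀ (q : ℕ → Bool) u → All (λ a → q a ≡ true) u → count q u ≡ length u
  count-all q []      []       = refl
  count-all q (a ∷ u) (e ∷ es) rewrite e = cong suc (count-all q u es)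

  count-none : ∀ (q : ℕ → Bool) u → All (λ a → q a ≡ false) u → count q u ≡ 0
  count-none q []      []       = refl
  count-none q (a ∷ u) (e ∷ es) rewrite e = count-none q u es

  count-≤ : ∀ (q : ℕ → Bool) p → count q p ≤ length p
  count-≤ q []      = z≤n
  count-≤ q (a ∷ p) with q a
  ... | true  = s≤s (count-≤ q p)
  ... | false = m≤n⇒m≤1+n (count-≤ q p)

  mmpAux-++ : ∀ k p u r → mmpAux k p (u ++ r) ≡ mmpAux k p u + mmpAux k (p ++ u) r
  mmpAux-++ k p []      r rewrite ++-identityʳ p = refl
  mmpAux-++ k p (b ∷ u) r rewrite mmpAux-++ k (p ++ [ b ]) u r | ++-assoc p [ b ] u =
    sym (+-assoc (if k ≤ᵇ count (λ a → a <ᵇ b) p then 1 else 0) (mmpAux k (p ++ [ b ]) u) _)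

  mmpAux-dominated : ∀ k X p v → All (λ b → All (λ x → b ≤ x) X) v → mmpAux k (X ++ p) v ≡ mmpAux k p v
  mmpAux-dominated k X p []      []       = refl
  mmpAux-dominated k X p (b ∷ v) (q ∷ qs)
    rewrite count-++ (λ a → a <ᵇ b) X p
          | count-none (λ a → a <ᵇ b) X (All.map <ᵇ-false q)
          | ++-assoc X p [ b ] = cong (_ +_) (mmpAux-dominated k X (p ++ [ b ]) v qs)

  mmp-max : ∀ k n u v → All (_< n) u → All (λ b → All (λ x → b ≤ x) (u ++ [ n ])) v →
    mmp k (u ++ n ∷ v) ≡ mmp k u + (ι (k ≤ᵇ length u) + mmp k v)
  mmp-max k n u v pu pv
    rewrite mmpAux-++ k [] u (n ∷ v)
          | count-all (λ a → a <ᵇ n) u (All.map <ᵇ-true pu)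
          | ι-if (k ≤ᵇ length u) =
    cong (λ z → mmpAux k [] u + (ι (k ≤ᵇ length u) + z))
      (trans (cong (λ q → mmpAux k q v) (sym (++-identityʳ (u ++ [ n ]))))
             (mmpAux-dominated k (u ++ [ n ]) [] v pv))

  mmpAux-short : ∀ k p u → length p + length u ≤ k → mmpAux k p u ≡ 0
  mmpAux-short k p []      le = refl
  mmpAux-short k p (b ∷ u) le
    rewrite ≤ᵇ-false {k} {count (λ a → a <ᵇ b) p}
              (≤-<-trans (count-≤ (λ a → a <ᵇ b) p) (<-≤-trans (m<m+n (length p) (s≤s z≤n)) le))
    = mmpAux-short k (p ++ [ b ]) u
        (subst (_≤ k) (sym (trans (cong (_+ length u) (length-++ p {[ b ]}))
                                  (+-assoc (length p) 1 (length u)))) le)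

  -- Pigeonhole: a distinct word with letters in [lo, hi) has length ≤ hi - lo.
  -- Proof: count the letters x < hi occurring in the word in two ways.

  occurrences : ℕ → List ℕ → ℕ
  occurrences hi w = ssum hi (λ x → ι (elem x w))

  occurrences-distinct : ∀ hi w → T (distinct w) → All (_< hi) w → occurrences hi w ≡ length w
  occurrences-distinct hi []      t []        = ssum-0 hi (λ _ _ → refl)
  occurrences-distinct hi (a ∷ w) t (ah ∷ ps) = begin
      ssum hi (λ x → ι ((x ≡ᵇ a) ∨ elem x w))
    ≡⟨ ssum-cong hi (λ x _ → split x) ⟩
      ssum hi (λ x → ι (x ≡ᵇ a) * 1 + ι (elem x w))
    ≡⟨ ssum-+ hi _ _ ⟩
      ssum hi (λ x → ι (x ≡ᵇ a) * 1) + occurrences hi w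
    ≡⟨ cong₂ _+_ (ssum-delta hi a (λ _ → 1)) (occurrences-distinct hi w (∧-r t) ps) ⟩
      ι (a <ᵇ hi) * 1 + length w
    ≡⟨ cong (λ z → ι z * 1 + length w) (<ᵇ-true ah) ⟩
      suc (length w)
    ∎
    where
    open ≡-Reasoning
    a∉w : elem a w ≡ false
    a∉w = not-T (∧-l t)
    split : ∀ x → ι ((x ≡ᵇ a) ∨ elem x w) ≡ ι (x ≡ᵇ a) * 1 + ι (elem x w)
    split x with x ≡ᵇ a in eq
    ... | true rewrite ≡ᵇ⇒≡ x a (subst T (sym eq) tt) | a∉w = refl
    ... | false = refl

  occurrences-bound : ∀ lo hi w → All (lo ≤_) w → occurrences hi w ≤ hi ∸ lo
  occurrences-bound lo hi w pl with ≤-total lo hi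
  ... | inj₂ hl = ≤-reflexive (trans (ssum-0 hi (λ x xh → absent x (<-≤-trans xh hl)))
                                     (sym (m≤n⇒m∸n≡0 hl)))
    where
    absent : ∀ x → x < lo → ι (elem x w) ≡ 0
    absent x xl = cong ι (elem-none x w (All.map (λ lb e → <⇒≢ (<-≤-trans xl lb) e) pl))
  ... | inj₁ lh = begin
      ssum hi (λ x → ι (elem x w))
    ≡⟨ cong (λ z → ssum z (λ x → ι (elem x w))) (sym (m+[n∸m]≡n lh)) ⟩
      ssum (lo + (hi ∸ lo)) (λ x → ι (elem x w))
    ≡⟨ ssum-split lo (hi ∸ lo) _ ⟩
      ssum lo (λ x → ι (elem x w)) + ssum (hi ∸ lo) (λ i → ι (elem (lo + i) w))
    ≡⟨ cong (_+ ssum (hi ∸ lo) (λ i → ι (elem (lo + i) w))) (ssum-0 lo absent) ⟩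
      ssum (hi ∸ lo) (λ i → ι (elem (lo + i) w))
    ≤⟨ ssum-≤1 (hi ∸ lo) _ (λ i → ι≤1 (elem (lo + i) w)) ⟩
      hi ∸ lo
    ∎
    where
    open ≤-Reasoning
    absent : ∀ x → x < lo → ι (elem x w) ≡ 0
    absent x xl = cong ι (elem-none x w (All.map (λ lb e → <⇒≢ (<-≤-trans xl lb) e) pl))

  pigeonhole : ∀ lo hi w → T (distinct w) → All (λ a → lo ≤ a × a < hi) w → length w ≤ hi ∸ lo
  pigeonhole lo hi w t p =
    subst (_≤ hi ∸ lo) (occurrences-distinct hi w t (All.map proj₂ p))
          (occurrences-bound lo hi w (All.map proj₁ p))

  pos : ℕ → List ℕ → ℕ
  pos n []      = 0
  pos n (a ∷ w) = if a ≡ᵇ n then 0 else suc (pos n w)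

  pos-split : ∀ n u c v → (pos n (u ++ c ∷ v) ≡ᵇ length u) ≡ (not (elem n u) ∧ (c ≡ᵇ n))
  pos-split n []      c v with c ≡ᵇ n
  ... | true  = refl
  ... | false = refl
  pos-split n (a ∷ u) c v rewrite ≡ᵇ-sym n a with a ≡ᵇ n
  ... | true  = refl
  ... | false = pos-split n u c v

  pos-< : ∀ n w → T (elem n w) → pos n w < length w
  pos-< n (a ∷ w) t rewrite ≡ᵇ-sym n a with a ≡ᵇ n
  ... | true  = s≤s z≤n
  ... | false = s≤s (pos-< n w t)

-- The decomposition σ = u n v of a 132-avoiding word σ of length n + 1
-- around its maximal letter n, at the level of single words: once the
-- position |u| = i of n is fixed, σ is counted iff u uses exactly the
-- top letters [n - i, n), v the bottom letters [0, n - i), and u, v are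
-- 132-avoiding with mmp(u) + [k ≤ i] + mmp(v) = m.
module MaximumDecomposition where

  open import Defs
  open BoolFacts
  open NatSums using (allB; inA)
  open WordStatistics
  open import Data.Bool using (Bool; true; false; not; _∧_; _∨_; T)
  open import Data.Bool.Properties using (∧-zeroʳ; ∧-identityʳ)
  open import Data.Nat using (ℕ; suc; _∸_; _+_; _*_; _≤_; _<_; _≤ᵇ_; _≡ᵇ_; z≤n; s≤s⁻¹)
  open import Data.Nat.Properties
  open import Data.List using (List; []; _∷_; _++_; length)
  open import Data.List.Relation.Unary.All as All using (All; []; _∷_)
  open import Data.List.Relation.Unary.All.Properties using (++⁺)
  open import Relation.Binary.PropositionalEquality hiding ([_])
  open import Data.Empty using (⊥)
  open import Data.Unit using (tt)
  open import Data.Product using (_×_; _,_; proj₁; proj₂)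

  counted : ℕ → ℕ → List ℕ → Bool
  counted k m w = distinct w ∧ not (contains132 w) ∧ (mmp k w ≡ᵇ m)

  avoids : List ℕ → Bool
  avoids w = distinct w ∧ not (contains132 w)

  upper lower : ℕ → ℕ → List ℕ → Bool
  upper n i = allB (inA (n ∸ i) i)
  lower n i = allB (inA 0 (n ∸ i))

  blocksOK : ℕ → ℕ → List ℕ → List ℕ → Bool
  blocksOK k m u v = avoids u ∧ (avoids v ∧ (mmp k u + (ι (k ≤ᵇ length u) + mmp k v) ≡ᵇ m))

  allB⇒All : ∀ (p : ℕ → Bool) u → T (allB p u) → All (λ a → T (p a)) u
  allB⇒All p []      t = []
  allB⇒All p (a ∷ u) t = ∧-l {p a} t ∷ allB⇒All p u (∧-r {p a} t)

  All⇒allB : ∀ (p : ℕ → Bool) u → All (λ a → T (p a)) u → T (allB p u)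
  All⇒allB p []      []       = tt
  All⇒allB p (a ∷ u) (x ∷ xs) = ∧-i x (All⇒allB p u xs)

  inA⇒ : ∀ s M a → T (inA s M a) → s ≤ a × a < s + M
  inA⇒ s M a t = ≤ᵇ⇒≤ s a (∧-l {s ≤ᵇ a} t) , <ᵇ⇒< a (s + M) (∧-r {s ≤ᵇ a} t)

  ⇒inA : ∀ s M a → s ≤ a → a < s + M → T (inA s M a)
  ⇒inA s M a p q = ∧-i (≤⇒≤ᵇ p) (<⇒<ᵇ q)

  transpose : ∀ {R : ℕ → ℕ → Set} u v →
    All (λ a → All (λ b → R a b) v) u → All (λ b → All (λ a → R a b) u) v
  transpose []      v []       = All.universal (λ _ → []) v
  transpose (a ∷ u) v (p ∷ ps) = All.zipWith (λ (x , y) → x ∷ y) (p , transpose u v ps)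

  below : ∀ a w → All (_≤ a) w → All (λ b → (a ≡ b → ⊥)) w → All (_< a) w
  below a []      []       []       = []
  below a (b ∷ w) (p ∷ ps) (q ∷ qs) = ≤∧≢⇒< p (λ e → q (sym e)) ∷ below a w ps qs

  -- If u n v is distinct and 132-avoiding (n the largest letter, not in u),
  -- the letters of u all exceed those of v, so by pigeonhole they fill
  -- exactly the windows [n - |u|, n) and [0, n - |u|).
  windows : ∀ n u v → length u ≤ n → length v ≡ n ∸ length u →
    All (_< suc n) u → All (_< suc n) v →
    T (distinct (u ++ n ∷ v)) → T (not (contains132 (u ++ n ∷ v))) → T (not (elem n u)) →
    T (upper n (length u) u) × T (lower n (length u) v)
  windows n u v i≤n lv pu pv td tc te =
    All⇒allB _ u (All.zipWith inUpper (v<u , u<n)) ,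
    All⇒allB _ v (All.zipWith inLower (transpose u v v<u , v<n))
    where
    i = length u
    parts = distinct-split u (n ∷ v) td
    du = proj₁ parts
    dnv = proj₁ (proj₂ parts)
    dv = ∧-r {not (elem n v)} dnv
    u<n : All (_< n) u
    u<n = below n u (All.map s≤s⁻¹ pu) (elem-none⁻¹ n u te)
    v<n : All (_< n) v
    v<n = below n v (All.map s≤s⁻¹ pv) (elem-none⁻¹ n v (∧-l {not (elem n v)} dnv))
    v<u : All (λ a → All (_< a) v) u
    v<u = All.zipWith (λ {a} (le , a∉v) → below a v le (elem-none⁻¹ a v (∨-r {a ≡ᵇ n} a∉v)))
                      (avoid132-max n u v v<n tc , proj₂ (proj₂ parts))
    -- |v| ≤ a because v is distinct inside [0, a)
    inUpper : ∀ {a} → All (_< a) v × a < n → T (inA (n ∸ i) i a)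
    inUpper {a} (p , q) = ⇒inA (n ∸ i) i a
      (subst (_≤ a) lv (pigeonhole 0 a v dv (All.map (λ x → z≤n , x) p)))
      (subst (a <_) (sym (m∸n+n≡m i≤n)) q)
    -- |u| ≤ n - (b + 1) because u is distinct inside [b + 1, n)
    inLower : ∀ {b} → All (b <_) u × b < n → T (inA 0 (n ∸ i) b)
    inLower {b} (p , q) = ⇒inA 0 (n ∸ i) b z≤n
      (m+n≤o⇒m≤o∸n (suc b) (subst (_≤ n) (+-comm i (suc b))
        (m≤o∸n⇒m+n≤o i q (pigeonhole (suc b) n u du (All.zipWith (λ (x , y) → x , y) (p , u<n))))))

  regroup-conditions : ∀ du dv cu cv x →
    ((du ∧ dv) ∧ (not (cu ∨ cv) ∧ x)) ∧ true ≡ (du ∧ not cu) ∧ ((dv ∧ not cv) ∧ x)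
  regroup-conditions true  true  false false x = ∧-identityʳ x
  regroup-conditions true  true  false true  x = refl
  regroup-conditions true  true  true  cv    x = refl
  regroup-conditions true  false false false x = refl
  regroup-conditions true  false false true  x = refl
  regroup-conditions true  false true  cv    x = refl
  regroup-conditions false dv    cu    cv    x = refl

  glue : ∀ k m n u v → length u ≤ n → T (upper n (length u) u) → T (lower n (length u) v) →
    counted k m (u ++ n ∷ v) ∧ (not (elem n u) ∧ true) ≡ blocksOK k m u v
  glue k m n u v i≤n tu tv = glued
    where
    i = length u
    ru : All (λ a → n ∸ i ≤ a × a < n ∸ i + i) u
    ru = All.map (inA⇒ (n ∸ i) i _) (allB⇒All _ u tu)
    rv : All (λ b → 0 ≤ b × b < 0 + (n ∸ i)) v
    rv = All.map (inA⇒ 0 (n ∸ i) _) (allB⇒All _ v tv)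
    u<n : All (_< n) u
    u<n = All.map (λ (_ , q) → subst (_ <_) (m∸n+n≡m i≤n) q) ru
    v<u : All (λ a → All (_< a) v) u
    v<u = All.map (λ (p , _) → All.map (λ (_ , q) → <-≤-trans q p) rv) ru
    v<n : All (_< n) v
    v<n = All.map (λ (_ , q) → <-≤-trans q (m∸n≤m n i)) rv
    n∉ : ∀ w → All (_< n) w → elem n w ≡ false
    n∉ w p = elem-none n w (All.map (λ q e → <⇒≢ q (sym e)) p)
    n∉u : elem n u ≡ false
    n∉u = n∉ u u<n
    distinct-glued : distinct (u ++ n ∷ v) ≡ distinct u ∧ distinct v
    distinct-glued = T-ext
      (λ t → let ds = distinct-split u (n ∷ v) t in ∧-i (proj₁ ds) (∧-r {not (elem n v)} (proj₁ (proj₂ ds))))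
      (λ t → distinct-join u (n ∷ v) (∧-l {distinct u} t)
               (∧-i (T-not (n∉ v v<n)) (∧-r {distinct u} t))
               (All.zipWith (λ {a} (q , r) → T-not {(a ≡ᵇ n) ∨ elem a v}
                   (trans (cong (_∨ elem a v) (≡ᵇ-false (<⇒≢ q)))
                          (elem-none a v (All.map (λ z e → <⇒≢ z (sym e)) r))))
                 (u<n , v<u)))
    glued : counted k m (u ++ n ∷ v) ∧ (not (elem n u) ∧ true) ≡ blocksOK k m u v
    glued rewrite n∉u | distinct-glued
                | contains132-max n u v (All.zipWith (λ (p , q) → All.map <⇒≤ p , q) (v<u , u<n))
                                        (All.map <⇒≤ v<n)
                | mmp-max k n u v u<n (All.zipWith (λ (p , q) → ++⁺ (All.map <⇒≤ p) (<⇒≤ q ∷ []))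
                                                   (transpose u v v<u , v<n)) =
      regroup-conditions (distinct u) (distinct v) (contains132 u) (contains132 v) _

  split-indicator : ∀ k m n u c v → length u ≤ n → length v ≡ n ∸ length u →
    All (_< suc n) u → All (_< suc n) v →
    ι (counted k m (u ++ c ∷ v) ∧ (pos n (u ++ c ∷ v) ≡ᵇ length u))
    ≡ ι (c ≡ᵇ n) * (ι (upper n (length u) u) * (ι (lower n (length u) v) * ι (blocksOK k m u v)))
  split-indicator k m n u c v i≤n lv pu pv rewrite pos-split n u c v with c ≡ᵇ n in c≟n
  ... | false rewrite ∧-zeroʳ (not (elem n u)) | ∧-zeroʳ (counted k m (u ++ c ∷ v)) = refl
  ... | true rewrite ≡ᵇ⇒≡ c n (subst T (sym c≟n) tt) =
    trans (cong ι (T-ext forth back))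
          (trans (ι∧ (upper n i u) _) (trans (cong (ι (upper n i u) *_) (ι∧ (lower n i v) _))
                 (sym (*-identityˡ _))))
    where
    i = length u
    B = counted k m (u ++ n ∷ v) ∧ (not (elem n u) ∧ true)
    forth : T B → T (upper n i u ∧ (lower n i v ∧ blocksOK k m u v))
    forth t with windows n u v i≤n lv pu pv
                   (∧-l {distinct (u ++ n ∷ v)} (∧-l {counted k m (u ++ n ∷ v)} t))
                   (∧-l {not (contains132 (u ++ n ∷ v))} (∧-r {distinct (u ++ n ∷ v)} (∧-l {counted k m (u ++ n ∷ v)} t)))
                   (∧-l {not (elem n u)} (∧-r {counted k m (u ++ n ∷ v)} t))
    ... | tu , tv = ∧-i tu (∧-i tv (subst T (glue k m n u v i≤n tu tv) t))
    back : T (upper n i u ∧ (lower n i v ∧ blocksOK k m u v)) → T B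
    back t = subst T (sym (glue k m n u v i≤n tu tv)) (∧-r {lower n i v} (∧-r {upper n i u} t))
      where
      tu = ∧-l {upper n i u} t
      tv = ∧-l {lower n i v} (∧-r {upper n i u} t)

-- Summing the single-word decomposition over all words gives the
-- recurrence for q(n, m) = qcount k n m:
--   q(n+1, m) = Σ_{i ≤ n} (if k ≤ i then Σ_{j<m} q(i,j) q(n-i,m-1-j)
--                                   else Σ_{j≤m} q(i,j) q(n-i,m-j)),
-- where i is the position of the maximum.
module DecompositionRecurrence where

  open import Defs
  open BoolFacts
  open NatSums
  open WordStatistics using (sh; distinct-sh; contains132-sh; mmp-sh; pos; pos-<; pigeonhole; elem-none⁻¹; mmpAux-short)
  open MaximumDecomposition
  open import Data.Bool using (Bool; true; false; not; _∧_; if_then_else_; T)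
  open import Data.Bool.Properties using (∧-zeroʳ)
  open import Data.Nat using (ℕ; zero; suc; _∸_; _+_; _*_; _≤_; _<_; _<ᵇ_; _≤ᵇ_; _≡ᵇ_; z≤n; s≤s; s≤s⁻¹; _≤?_)
  open import Data.Nat.Properties
  open import Data.Nat.Tactic.RingSolver using (solve-∀)
  open import Data.List using (List; []; _∷_; _++_; map; length)
  open import Data.List.Properties using (length-map)
  open import Data.List.Relation.Unary.All as All using (All)
  open import Relation.Binary.PropositionalEquality
  open import Relation.Nullary using (Dec; yes; no)
  open import Data.Empty using (⊥-elim)
  open import Data.Unit using (tt)
  open import Data.Product using (_,_)

  qcount-Σw : ∀ k n m → qcount k n m ≡ Σw n n (λ w → ι (counted k m w))
  qcount-Σw k n m = length-filter (counted k m) (words n n)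

  -- a permutation of [0, n] contains its maximum n (pigeonhole on [0, n))
  contains-max : ∀ n w → IsWord (suc n) (suc n) w → T (distinct w) → T (elem n w)
  contains-max n w wd t with elem n w in n∈w
  ... | true  = tt
  ... | false = ⊥-elim (<-irrefl refl (subst (_≤ n) (IsWord-length wd)
        (pigeonhole 0 n w t (All.map (λ x → z≤n , x)
          (below n w (All.map s≤s⁻¹ (IsWord-letters wd))
                     (elem-none⁻¹ n w (subst (λ z → T (not z)) (sym n∈w) tt)))))))

  by-max-position : ∀ k m n w → IsWord (suc n) (suc n) w →
    ι (counted k m w) ≡ ssum (suc n) (λ i → ι (counted k m w ∧ (pos n w ≡ᵇ i)))
  by-max-position k m n w wd = sym (begin
      ssum (suc n) (λ i → ι (counted k m w ∧ (pos n w ≡ᵇ i)))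
    ≡⟨ ssum-cong (suc n) (λ i _ → trans (ι∧ (counted k m w) (pos n w ≡ᵇ i))
                                        (cong (ι (counted k m w) *_)
                                              (trans (cong ι (≡ᵇ-sym (pos n w) i)) (sym (*-identityʳ _))))) ⟩
      ssum (suc n) (λ i → ι (counted k m w) * (ι (i ≡ᵇ pos n w) * 1))
    ≡⟨ ssum-* (suc n) (ι (counted k m w)) _ ⟩
      ι (counted k m w) * ssum (suc n) (λ i → ι (i ≡ᵇ pos n w) * 1)
    ≡⟨ cong (ι (counted k m w) *_) (ssum-delta (suc n) (pos n w) (λ _ → 1)) ⟩
      ι (counted k m w) * (ι (pos n w <ᵇ suc n) * 1)
    ≡⟨ position-in-range (counted k m w) refl ⟩
      ι (counted k m w)
    ∎)
    where
    open ≡-Reasoning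
    position-in-range : ∀ b → counted k m w ≡ b → ι b * (ι (pos n w <ᵇ suc n) * 1) ≡ ι b
    position-in-range false _ = refl
    position-in-range true e
      rewrite <ᵇ-true (subst (pos n w <_) (IsWord-length wd)
                        (pos-< n w (contains-max n w wd (∧-l {distinct w} (subst T (sym e) tt))))) = refl

  middle-is-max : ∀ k m n i → i ≤ n → ∀ v → IsWord (suc n) (n ∸ i) v →
    ssum (suc n) (λ c → Σw i (suc n) (λ u → ι (counted k m (u ++ c ∷ v) ∧ (pos n (u ++ c ∷ v) ≡ᵇ i))))
    ≡ Σw i (suc n) (λ u → ι (upper n i u) * (ι (lower n i v) * ι (blocksOK k m u v)))
  middle-is-max k m n i i≤n v wv = begin
      ssum N (λ c → Σw i N (λ u → ι (counted k m (u ++ c ∷ v) ∧ (pos n (u ++ c ∷ v) ≡ᵇ i))))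
    ≡⟨ ssum-cong N (λ c _ → trans (Σw-cong i N (λ u wu → factor u c wu)) (Σl-* (words i N) (ι (c ≡ᵇ n)) G)) ⟩
      ssum N (λ c → ι (c ≡ᵇ n) * Σw i N G)
    ≡⟨ ssum-delta N n (λ _ → Σw i N G) ⟩
      ι (n <ᵇ N) * Σw i N G
    ≡⟨ cong (λ z → ι z * Σw i N G) (<ᵇ-true (n<1+n n)) ⟩
      1 * Σw i N G
    ≡⟨ *-identityˡ _ ⟩
      Σw i N G
    ∎
    where
    open ≡-Reasoning
    N = suc n
    G : List ℕ → ℕ
    G u = ι (upper n i u) * (ι (lower n i v) * ι (blocksOK k m u v))
    factor : ∀ u c → IsWord N i u →
      ι (counted k m (u ++ c ∷ v) ∧ (pos n (u ++ c ∷ v) ≡ᵇ i)) ≡ ι (c ≡ᵇ n) * G u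
    factor u c wu with IsWord-length wu
    ... | refl = split-indicator k m n u c v i≤n (IsWord-length wv) (IsWord-letters wu) (IsWord-letters wv)

  max-at-position : ∀ k m n i → i ≤ n →
    Σw (suc n) (suc n) (λ w → ι (counted k m w ∧ (pos n w ≡ᵇ i)))
    ≡ Σw (n ∸ i) (suc n) (λ v → Σw i (suc n) (λ u →
        ι (upper n i u) * (ι (lower n i v) * ι (blocksOK k m u v))))
  max-at-position k m n i i≤n = begin
      Σw (suc n) N F
    ≡⟨ cong (λ z → Σw z N F) (sym (trans (+-suc i (n ∸ i)) (cong suc (m+[n∸m]≡n i≤n)))) ⟩
      Σw (i + suc (n ∸ i)) N F
    ≡⟨ Σw-++ i (suc (n ∸ i)) N F ⟩
      Σw (suc (n ∸ i)) N (λ r → Σw i N (λ u → F (u ++ r)))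
    ≡⟨ Σw-suc (n ∸ i) N (λ r → Σw i N (λ u → F (u ++ r))) ⟩
      Σw (n ∸ i) N (λ v → ssum N (λ c → Σw i N (λ u → F (u ++ c ∷ v))))
    ≡⟨ Σw-cong (n ∸ i) N (middle-is-max k m n i i≤n) ⟩
      Σw (n ∸ i) N (λ v → Σw i N (λ u → ι (upper n i u) * (ι (lower n i v) * ι (blocksOK k m u v))))
    ∎
    where
    open ≡-Reasoning
    N = suc n
    F : List ℕ → ℕ
    F w = ι (counted k m w ∧ (pos n w ≡ᵇ i))

  windows-shift : ∀ n i → i ≤ n → (g : List ℕ → List ℕ → ℕ) →
    Σw (n ∸ i) (suc n) (λ v → Σw i (suc n) (λ u → ι (upper n i u) * (ι (lower n i v) * g u v)))
    ≡ Σw (n ∸ i) (n ∸ i) (λ v → Σw i i (λ u → g (sh (n ∸ i) u) v))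
  windows-shift n i i≤n g = begin
      Σw (n ∸ i) N (λ v → Σw i N (λ u → ι (upper n i u) * (ι (lower n i v) * g u v)))
    ≡⟨ Σl-cong (words (n ∸ i) N) (λ v →
         trans (Σw-window i N (n ∸ i) i upper-fits (λ u → ι (lower n i v) * g u v))
               (Σl-* (words i i) (ι (lower n i v)) (λ u → g (sh (n ∸ i) u) v))) ⟩
      Σw (n ∸ i) N (λ v → ι (lower n i v) * Σw i i (λ u → g (sh (n ∸ i) u) v))
    ≡⟨ Σw-window (n ∸ i) N 0 (n ∸ i) lower-fits (λ v → Σw i i (λ u → g (sh (n ∸ i) u) v)) ⟩
      Σw (n ∸ i) (n ∸ i) (λ v → Σw i i (λ u → g (sh (n ∸ i) u) (map (0 +_) v)))
    ≡⟨ Σl-cong (words (n ∸ i) (n ∸ i)) (λ v → cong (λ v' → Σw i i (λ u → g (sh (n ∸ i) u) v')) (sh0 v)) ⟩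
      Σw (n ∸ i) (n ∸ i) (λ v → Σw i i (λ u → g (sh (n ∸ i) u) v))
    ∎
    where
    open ≡-Reasoning
    N = suc n
    upper-fits : n ∸ i + i ≤ N
    upper-fits = subst (_≤ N) (sym (m∸n+n≡m i≤n)) (n≤1+n n)
    lower-fits : 0 + (n ∸ i) ≤ N
    lower-fits = ≤-trans (m∸n≤m n i) (n≤1+n n)
    sh0 : ∀ v → map (0 +_) v ≡ v
    sh0 []      = refl
    sh0 (a ∷ v) = cong (a ∷_) (sh0 v)

  blocksOK-sh : ∀ k m s u v → blocksOK k m (sh s u) v ≡ blocksOK k m u v
  blocksOK-sh k m s u v
    rewrite distinct-sh s u | contains132-sh s u | mmp-sh k s u | length-map (s +_) u = refl

  sum-indicator : ∀ a b M → ι (a + b ≡ᵇ M) ≡ ssum (suc M) (λ j → ι (a ≡ᵇ j) * ι (b ≡ᵇ M ∸ j))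
  sum-indicator a b M =
    sym (trans (ssum-cong (suc M) (λ j _ → cong (λ z → ι z * ι (b ≡ᵇ M ∸ j)) (≡ᵇ-sym a j)))
               (trans (ssum-delta (suc M) a (λ j → ι (b ≡ᵇ M ∸ j))) (by-cases (a ≤? M))))
    where
    by-cases : Dec (a ≤ M) → ι (a <ᵇ suc M) * ι (b ≡ᵇ M ∸ a) ≡ ι (a + b ≡ᵇ M)
    by-cases (yes le) rewrite <ᵇ-true (s≤s le) = trans (+-identityʳ _) (cong ι (T-ext
        (λ t → ≡⇒≡ᵇ (a + b) M (trans (cong (a +_) (≡ᵇ⇒≡ b (M ∸ a) t)) (m+[n∸m]≡n le)))
        (λ t → ≡⇒≡ᵇ b (M ∸ a) (trans (sym (m+n∸m≡n a b)) (cong (_∸ a) (≡ᵇ⇒≡ (a + b) M t))))))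
    by-cases (no nle) rewrite <ᵇ-false {a} {suc M} (≰⇒> nle) =
      sym (cong ι (¬T⇒≡false (λ t → nle (subst (a ≤_) (≡ᵇ⇒≡ (a + b) M t) (m≤m+n a b)))))

  conv : ℕ → ℕ → ℕ → ℕ → ℕ
  conv k a b M = ssum (suc M) (λ j → qcount k a j * qcount k b (M ∸ j))

  ι-counted : ∀ k j u → ι (counted k j u) ≡ ι (avoids u) * ι (mmp k u ≡ᵇ j)
  ι-counted k j u rewrite ι∧ (distinct u) (not (contains132 u) ∧ (mmp k u ≡ᵇ j))
                        | ι∧ (not (contains132 u)) (mmp k u ≡ᵇ j)
                        | ι∧ (distinct u) (not (contains132 u)) = sym (*-assoc (ι (distinct u)) _ _)

  pair-indicator : ∀ k M u v →
    ι (avoids u) * (ι (avoids v) * ι (mmp k u + mmp k v ≡ᵇ M))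
    ≡ ssum (suc M) (λ j → ι (counted k j u) * ι (counted k (M ∸ j) v))
  pair-indicator k M u v = begin
      ι (avoids u) * (ι (avoids v) * ι (mmp k u + mmp k v ≡ᵇ M))
    ≡⟨ cong (λ z → ι (avoids u) * (ι (avoids v) * z)) (sum-indicator (mmp k u) (mmp k v) M) ⟩
      ι (avoids u) * (ι (avoids v) * ssum (suc M) (λ j → ι (mmp k u ≡ᵇ j) * ι (mmp k v ≡ᵇ M ∸ j)))
    ≡⟨ cong (ι (avoids u) *_) (sym (ssum-* (suc M) (ι (avoids v)) _)) ⟩
      ι (avoids u) * ssum (suc M) (λ j → ι (avoids v) * (ι (mmp k u ≡ᵇ j) * ι (mmp k v ≡ᵇ M ∸ j)))
    ≡⟨ sym (ssum-* (suc M) (ι (avoids u)) _) ⟩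
      ssum (suc M) (λ j → ι (avoids u) * (ι (avoids v) * (ι (mmp k u ≡ᵇ j) * ι (mmp k v ≡ᵇ M ∸ j))))
    ≡⟨ ssum-cong (suc M) (λ j _ → trans (regroup (ι (avoids u)) (ι (avoids v)) _ _)
                                        (sym (cong₂ _*_ (ι-counted k j u) (ι-counted k (M ∸ j) v)))) ⟩
      ssum (suc M) (λ j → ι (counted k j u) * ι (counted k (M ∸ j) v))
    ∎
    where
    open ≡-Reasoning
    regroup : ∀ x y p q → x * (y * (p * q)) ≡ (x * p) * (y * q)
    regroup = solve-∀

  pairs-count : ∀ k a b M →
    Σw b b (λ v → Σw a a (λ u → ι (avoids u) * (ι (avoids v) * ι (mmp k u + mmp k v ≡ᵇ M))))
    ≡ conv k a b M
  pairs-count k a b M = begin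
      Σw b b (λ v → Σw a a (λ u → ι (avoids u) * (ι (avoids v) * ι (mmp k u + mmp k v ≡ᵇ M))))
    ≡⟨ Σl-cong (words b b) (λ v → Σl-cong (words a a) (λ u → pair-indicator k M u v)) ⟩
      Σw b b (λ v → Σw a a (λ u → ssum (suc M) (λ j → A j u * B j v)))
    ≡⟨ Σl-cong (words b b) (λ v → trans (Σl-ssum (words a a) (suc M) (λ j u → A j u * B j v))
                                        (ssum-cong (suc M) (λ j _ → factor j v))) ⟩
      Σw b b (λ v → ssum (suc M) (λ j → Σw a a (A j) * B j v))
    ≡⟨ Σl-ssum (words b b) (suc M) (λ j v → Σw a a (A j) * B j v) ⟩
      ssum (suc M) (λ j → Σw b b (λ v → Σw a a (A j) * B j v))
    ≡⟨ ssum-cong (suc M) (λ j _ → trans (Σl-* (words b b) (Σw a a (A j)) (B j))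
                                        (sym (cong₂ _*_ (qcount-Σw k a j) (qcount-Σw k b (M ∸ j))))) ⟩
      conv k a b M
    ∎
    where
    open ≡-Reasoning
    A : ℕ → List ℕ → ℕ
    A j u = ι (counted k j u)
    B : ℕ → List ℕ → ℕ
    B j v = ι (counted k (M ∸ j) v)
    factor : ∀ j v → Σw a a (λ u → A j u * B j v) ≡ Σw a a (A j) * B j v
    factor j v = trans (Σl-cong (words a a) (λ u → *-comm (A j u) (B j v)))
                       (trans (Σl-* (words a a) (B j v) (A j)) (*-comm (B j v) _))

  -- conv shifted by one in m: the contribution of blocks u of length ≥ k
  conv⁺ : ℕ → ℕ → ℕ → ℕ → ℕ
  conv⁺ k a b zero    = 0
  conv⁺ k a b (suc M) = conv k a b M

  blockCount : ℕ → ℕ → ℕ → ℕ → ℕ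
  blockCount k n m i = if k ≤ᵇ i then conv⁺ k i (n ∸ i) m else conv k i (n ∸ i) m

  blocks-count : ∀ k m n i →
    Σw (n ∸ i) (n ∸ i) (λ v → Σw i i (λ u → ι (blocksOK k m u v))) ≡ blockCount k n m i
  blocks-count k m n i =
    trans (Σl-cong (words (n ∸ i) (n ∸ i)) (λ v → Σw-cong i i (λ u wu → unfold u v (IsWord-length wu))))
          (by-bonus (k ≤ᵇ i) m)
    where
    Z : Bool → ℕ → List ℕ → List ℕ → ℕ
    Z b m u v = ι (avoids u) * (ι (avoids v) * ι (mmp k u + (ι b + mmp k v) ≡ᵇ m))
    unfold : ∀ u v → length u ≡ i → ι (blocksOK k m u v) ≡ Z (k ≤ᵇ i) m u v
    unfold u v refl = trans (ι∧ (avoids u) _) (cong (ι (avoids u) *_) (ι∧ (avoids v) _))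
    by-bonus : ∀ b m → Σw (n ∸ i) (n ∸ i) (λ v → Σw i i (λ u → Z b m u v))
                      ≡ (if b then conv⁺ k i (n ∸ i) m else conv k i (n ∸ i) m)
    by-bonus false m = pairs-count k i (n ∸ i) m
    by-bonus true zero =
      trans (Σl-cong (words (n ∸ i) (n ∸ i)) (λ v → trans (Σl-cong (words i i) (λ u → none u v))
                                                          (Σl-0 (words i i))))
            (Σl-0 (words (n ∸ i) (n ∸ i)))
      where
      none : ∀ u v → Z true zero u v ≡ 0
      none u v rewrite +-suc (mmp k u) (mmp k v) =
        trans (cong (ι (avoids u) *_) (*-zeroʳ (ι (avoids v)))) (*-zeroʳ (ι (avoids u)))
    by-bonus true (suc M) =
      trans (Σl-cong (words (n ∸ i) (n ∸ i)) (λ v → Σl-cong (words i i) (λ u → shift u v)))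
            (pairs-count k i (n ∸ i) M)
      where
      shift : ∀ u v → Z true (suc M) u v ≡ ι (avoids u) * (ι (avoids v) * ι (mmp k u + mmp k v ≡ᵇ M))
      shift u v rewrite +-suc (mmp k u) (mmp k v) = refl

  qcount-rec : ∀ k n m → qcount k (suc n) m ≡ ssum (suc n) (blockCount k n m)
  qcount-rec k n m = begin
      qcount k (suc n) m
    ≡⟨ qcount-Σw k (suc n) m ⟩
      Σw (suc n) (suc n) (λ w → ι (counted k m w))
    ≡⟨ Σw-cong (suc n) (suc n) (λ w wd → by-max-position k m n w wd) ⟩
      Σw (suc n) (suc n) (λ w → ssum (suc n) (λ i → ι (counted k m w ∧ (pos n w ≡ᵇ i))))
    ≡⟨ Σl-ssum (words (suc n) (suc n)) (suc n) (λ i w → ι (counted k m w ∧ (pos n w ≡ᵇ i))) ⟩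
      ssum (suc n) (λ i → Σw (suc n) (suc n) (λ w → ι (counted k m w ∧ (pos n w ≡ᵇ i))))
    ≡⟨ ssum-cong (suc n) (λ i i<n → count-at i (s≤s⁻¹ i<n)) ⟩
      ssum (suc n) (blockCount k n m)
    ∎
    where
    open ≡-Reasoning
    count-at : ∀ i → i ≤ n →
      Σw (suc n) (suc n) (λ w → ι (counted k m w ∧ (pos n w ≡ᵇ i))) ≡ blockCount k n m i
    count-at i i≤n = begin
        Σw (suc n) (suc n) (λ w → ι (counted k m w ∧ (pos n w ≡ᵇ i)))
      ≡⟨ max-at-position k m n i i≤n ⟩
        Σw (n ∸ i) (suc n) (λ v → Σw i (suc n) (λ u →
          ι (upper n i u) * (ι (lower n i v) * ι (blocksOK k m u v))))
      ≡⟨ windows-shift n i i≤n (λ u v → ι (blocksOK k m u v)) ⟩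
        Σw (n ∸ i) (n ∸ i) (λ v → Σw i i (λ u → ι (blocksOK k m (sh (n ∸ i) u) v)))
      ≡⟨ Σl-cong (words (n ∸ i) (n ∸ i)) (λ v →
           Σl-cong (words i i) (λ u → cong ι (blocksOK-sh k m (n ∸ i) u v))) ⟩
        Σw (n ∸ i) (n ∸ i) (λ v → Σw i i (λ u → ι (blocksOK k m u v)))
      ≡⟨ blocks-count k m n i ⟩
        blockCount k n m i
      ∎

  qcount-short : ∀ k i m → i ≤ k → qcount k i (suc m) ≡ 0
  qcount-short k i m le =
    trans (qcount-Σw k i (suc m))
          (trans (Σw-cong i i (λ w wd → none w (IsWord-length wd))) (Σl-0 (words i i)))
    where
    none : ∀ w → length w ≡ i → ι (counted k (suc m) w) ≡ 0
    none w lw rewrite mmpAux-short k [] w (subst (_≤ k) (sym lw) le)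
                    | ∧-zeroʳ (not (contains132 w)) | ∧-zeroʳ (distinct w) = refl

-- Route: the recurrence and the
-- symmetry i ↦ n - i give (n + 2) a_{n+1} = (4n + 2) a_n, which is also the
-- ratio of consecutive terms binom(2n,n) / (n + 1).
module Catalan where

  open import Defs using (catalan)
  open NatSums using (ssum; ssum-cong; ssum-first; ssum-+; ssum-*; ssum-rev)
  open import Data.Nat using (ℕ; zero; suc; _∸_; _+_; _*_; _≤_; _<_; s≤s; s≤s⁻¹)
  open import Data.Nat.Properties
  open import Data.Nat.Combinatorics using (_C_; nC1≡n; nCk≡nC[n∸k]; nCk+nC[k+1]≡[n+1]C[k+1])
  open import Data.Nat.DivMod using (_/_; m*n/n≡m)
  open import Data.Nat.Tactic.RingSolver using (solve-∀)
  open import Relation.Binary.PropositionalEquality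
  open import Data.Sum using (inj₁; inj₂)

  absorption : ∀ n k → suc k * (suc n C suc k) ≡ suc n * (n C k)
  absorption zero    zero    = refl
  absorption zero    (suc k) = *-zeroʳ (suc (suc k))
  absorption (suc n) zero    =
    trans (+-identityʳ _) (trans (nC1≡n (suc (suc n))) (sym (*-identityʳ (suc (suc n)))))
  absorption (suc n) (suc k) = begin
      suc (suc k) * (suc (suc n) C suc (suc k))
    ≡⟨ cong (suc (suc k) *_) (sym (nCk+nC[k+1]≡[n+1]C[k+1] (suc n) (suc k))) ⟩
      suc (suc k) * (X + Y)
    ≡⟨ distribute (suc k) X Y ⟩
      X + (suc k * X + suc (suc k) * Y)
    ≡⟨ cong (X +_) (cong₂ _+_ (absorption n k) (absorption n (suc k))) ⟩
      X + (suc n * (n C k) + suc n * (n C suc k))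
    ≡⟨ cong (X +_) (sym (*-distribˡ-+ (suc n) (n C k) (n C suc k))) ⟩
      X + suc n * (n C k + n C suc k)
    ≡⟨ cong (λ z → X + suc n * z) (nCk+nC[k+1]≡[n+1]C[k+1] n k) ⟩
      suc (suc n) * X
    ∎
    where
    open ≡-Reasoning
    X = suc n C suc k
    Y = suc n C suc (suc k)
    distribute : ∀ a x y → suc a * (x + y) ≡ x + (a * x + suc a * y)
    distribute = solve-∀

  central : ℕ → ℕ
  central n = (2 * n) C n

  central-ratio : ∀ n → suc n * central (suc n) ≡ (4 * n + 2) * central n
  central-ratio n = begin
      suc n * ((2 * suc n) C suc n)
    ≡⟨ cong (λ z → suc n * (z C suc n)) (*-suc 2 n) ⟩
      suc n * (suc (suc (2 * n)) C suc n)
    ≡⟨ cong (suc n *_) (sym (nCk+nC[k+1]≡[n+1]C[k+1] (suc (2 * n)) n)) ⟩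
      suc n * (suc (2 * n) C n + suc (2 * n) C suc n)
    ≡⟨ cong (λ z → suc n * (z + suc (2 * n) C suc n)) symmetric ⟩
      suc n * (suc (2 * n) C suc n + suc (2 * n) C suc n)
    ≡⟨ double (suc n) (suc (2 * n) C suc n) ⟩
      2 * (suc n * (suc (2 * n) C suc n))
    ≡⟨ cong (2 *_) (absorption (2 * n) n) ⟩
      2 * (suc (2 * n) * central n)
    ≡⟨ normalise n (central n) ⟩
      (4 * n + 2) * central n
    ∎
    where
    open ≡-Reasoning
    double : ∀ a x → a * (x + x) ≡ 2 * (a * x)
    double = solve-∀
    normalise : ∀ n b → 2 * (suc (2 * n) * b) ≡ (4 * n + 2) * b
    normalise = solve-∀
    symmetric : suc (2 * n) C n ≡ suc (2 * n) C suc n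
    symmetric = trans (nCk≡nC[n∸k] (≤-trans (m≤m+n n (n + 0)) (n≤1+n (2 * n))))
                      (cong (suc (2 * n) C_) complement)
      where
      complement : suc (2 * n) ∸ n ≡ suc n
      complement = trans (cong (λ z → suc (n + z) ∸ n) (+-identityʳ n))
                         (trans (+-∸-assoc 1 (m≤m+n n n)) (cong suc (m+n∸m≡n n n)))

  weighted-symmetric-sum : ∀ n p c X → (∀ i → i ≤ n → X (n ∸ i) ≡ X i) →
    2 * ssum (suc n) (λ i → (p * i + c) * X i) ≡ (p * n + 2 * c) * ssum (suc n) X
  weighted-symmetric-sum n p c X sym-X = begin
      2 * S
    ≡⟨ cong (S +_) (+-identityʳ S) ⟩
      S + S
    ≡⟨ cong (S +_) (trans (ssum-rev n _) (ssum-cong (suc n) (λ i i< → cong ((p * (n ∸ i) + c) *_) (sym-X i (s≤s⁻¹ i<))))) ⟩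
      S + ssum (suc n) (λ i → (p * (n ∸ i) + c) * X i)
    ≡⟨ sym (ssum-+ (suc n) _ _) ⟩
      ssum (suc n) (λ i → (p * i + c) * X i + (p * (n ∸ i) + c) * X i)
    ≡⟨ ssum-cong (suc n) (λ i i< → pair i (s≤s⁻¹ i<)) ⟩
      ssum (suc n) (λ i → (p * n + 2 * c) * X i)
    ≡⟨ ssum-* (suc n) (p * n + 2 * c) X ⟩
      (p * n + 2 * c) * ssum (suc n) X
    ∎
    where
    open ≡-Reasoning
    S = ssum (suc n) (λ i → (p * i + c) * X i)
    collect : ∀ p i j c x → (p * i + c) * x + (p * j + c) * x ≡ (p * (i + j) + 2 * c) * x
    collect = solve-∀
    pair : ∀ i → i ≤ n → (p * i + c) * X i + (p * (n ∸ i) + c) * X i ≡ (p * n + 2 * c) * X i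
    pair i le = trans (collect p i (n ∸ i) c (X i)) (cong (λ z → (p * z + 2 * c) * X i) (m+[n∸m]≡n le))

  module _ (a : ℕ → ℕ) (K : ℕ) (a₀ : a 0 ≡ 1)
           (rec : ∀ n → suc n < K → a (suc n) ≡ ssum (suc n) (λ i → a i * a (n ∸ i))) where

    Ratio : ℕ → Set
    Ratio j = (j + 2) * a (suc j) ≡ (4 * j + 2) * a j

    convolution-symmetric : ∀ n i → i ≤ n → a (n ∸ i) * a (n ∸ (n ∸ i)) ≡ a i * a (n ∸ i)
    convolution-symmetric n i le = trans (cong (λ z → a (n ∸ i) * a z) (m∸[m∸n]≡n le)) (*-comm (a (n ∸ i)) (a i))

    -- Ratio n from Ratio j for all j < n: the weighted sum Σ (i + 1) a_i a_{n-i}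
    -- is computed twice, once by symmetry and once by shifting i ↦ i + 1.
    ratio-step : ∀ n → (∀ j → j < n → suc j < K → Ratio j) → suc n < K → Ratio n
    ratio-step zero     _  lt rewrite rec 0 lt | a₀ = refl
    ratio-step (suc n') ih lt = begin
        (n + 2) * a (suc n)
      ≡⟨ cong ((n + 2) *_) (rec n lt) ⟩
        (n + 2) * ssum (suc n) X
      ≡⟨ cong (_* ssum (suc n) X) (solve₁ n) ⟩
        (1 * n + 2 * 1) * ssum (suc n) X
      ≡⟨ sym (weighted-symmetric-sum n 1 1 X (convolution-symmetric n)) ⟩
        2 * ssum (suc n) (λ i → (1 * i + 1) * X i)
      ≡⟨ cong (2 *_) (ssum-first (suc n') _) ⟩
        2 * ((1 * 0 + 1) * X 0 + ssum (suc n') (λ i → (1 * suc i + 1) * X (suc i)))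
      ≡⟨ cong (λ z → 2 * ((1 * 0 + 1) * X 0 + z)) (ssum-cong (suc n') (λ i i< → lower-index i (s≤s⁻¹ i<))) ⟩
        2 * ((1 * 0 + 1) * X 0 + ssum (suc n') (λ i → 2 * ((2 * i + 1) * Y i)))
      ≡⟨ cong (λ z → 2 * ((1 * 0 + 1) * X 0 + z))
              (trans (ssum-* (suc n') 2 _) (weighted-symmetric-sum n' 2 1 Y (convolution-symmetric n'))) ⟩
        2 * ((1 * 0 + 1) * X 0 + (2 * n' + 2 * 1) * ssum (suc n') Y)
      ≡⟨ cong (λ z → 2 * ((1 * 0 + 1) * X 0 + (2 * n' + 2 * 1) * z)) (sym (rec n' (<-trans (n<1+n (suc n')) lt))) ⟩
        2 * ((1 * 0 + 1) * X 0 + (2 * n' + 2 * 1) * a n)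
      ≡⟨ cong (λ z → 2 * ((1 * 0 + 1) * z + (2 * n' + 2 * 1) * a n)) (trans (cong (_* a n) a₀) (+-identityʳ (a n))) ⟩
        2 * ((1 * 0 + 1) * a n + (2 * n' + 2 * 1) * a n)
      ≡⟨ solve₄ n' (a n) ⟩
        (4 * n + 2) * a n
      ∎
      where
      open ≡-Reasoning
      n = suc n'
      X : ℕ → ℕ
      X i = a i * a (n ∸ i)
      Y : ℕ → ℕ
      Y i = a i * a (n' ∸ i)
      solve₁ : ∀ n → n + 2 ≡ 1 * n + 2 * 1
      solve₁ = solve-∀
      solve₂ : ∀ i x y → (1 * suc i + 1) * (x * y) ≡ ((i + 2) * x) * y
      solve₂ = solve-∀
      solve₃ : ∀ i x y → ((4 * i + 2) * x) * y ≡ 2 * ((2 * i + 1) * (x * y))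
      solve₃ = solve-∀
      solve₄ : ∀ n' x → 2 * ((1 * 0 + 1) * x + (2 * n' + 2 * 1) * x) ≡ (4 * suc n' + 2) * x
      solve₄ = solve-∀
      lower-index : ∀ i → i ≤ n' → (1 * suc i + 1) * X (suc i) ≡ 2 * ((2 * i + 1) * Y i)
      lower-index i le = trans (solve₂ i (a (suc i)) (a (n' ∸ i)))
                 (trans (cong (_* a (n' ∸ i)) (ih i (s≤s le) (<-≤-trans (s≤s (s≤s le)) (<⇒≤ lt))))
                        (solve₃ i (a i) (a (n' ∸ i))))

    ratio : ∀ n j → j < n → suc j < K → Ratio j
    ratio (suc n) j j< lt with m≤n⇒m<n∨m≡n (s≤s⁻¹ j<)
    ... | inj₁ j<n  = ratio n j j<n lt
    ... | inj₂ refl = ratio-step j (ratio j) lt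

    -- (n + 1) a_n = binom(2n, n): both sides have the same ratios
    times-succ : ∀ n → n < K → suc n * a n ≡ central n
    times-succ zero    _  = trans (+-identityʳ (a 0)) a₀
    times-succ (suc n) lt = *-cancelˡ-≡ (suc (suc n) * a (suc n)) (central (suc n)) (suc n) (begin
        suc n * (suc (suc n) * a (suc n))
      ≡⟨ cong (suc n *_) (trans (cong (_* a (suc n)) (+-comm 2 n)) (ratio (suc n) n ≤-refl lt)) ⟩
        suc n * ((4 * n + 2) * a n)
      ≡⟨ swap-factors (suc n) (4 * n + 2) (a n) ⟩
        (4 * n + 2) * (suc n * a n)
      ≡⟨ cong ((4 * n + 2) *_) (times-succ n (<-trans (n<1+n n) lt)) ⟩
        (4 * n + 2) * central n
      ≡⟨ sym (central-ratio n) ⟩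
        suc n * central (suc n)
      ∎)
      where
      open ≡-Reasoning
      swap-factors : ∀ x y z → x * (y * z) ≡ y * (x * z)
      swap-factors = solve-∀

    catalan-recurrence : ∀ n → n < K → a n ≡ catalan n
    catalan-recurrence n lt =
      sym (trans (cong (_/ suc n) (sym (times-succ n lt)))
                 (trans (cong (_/ suc n) (*-comm (suc n) (a n))) (m*n/n≡m (a n) (suc n))))

-- Instead of proving that
-- ⊗ is associative we use the shift operators T (multiply by t), X
-- (multiply by x) and scalar multiplication sc, which commute with ⊗;
-- together with commutativity, distributivity and the unit law this is all
-- the algebra the theorem needs.
module PowerSeries where

  open import Defs
  open import Data.Nat using (ℕ; zero; suc; _∸_; _≤_; z≤n)
  open import Data.Nat.Properties using (m≤n⇒m≤1+n; ≤-refl; m∸[m∸n]≡n)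
  open import Data.Integer using (ℤ; +_; _+_; _*_; _-_)
  open import Data.Integer.Properties using (+-assoc; +-comm; +-identityˡ; +-identityʳ; *-comm; *-assoc;
    *-identityˡ; *-identityʳ; *-zeroʳ; *-distribˡ-+)
  open import Data.Integer.Tactic.RingSolver using (solve-∀)
  open import Relation.Binary.PropositionalEquality

  sumTo-cong : ∀ n {f g : ℕ → ℤ} → (∀ i → i ≤ n → f i ≡ g i) → sumTo n f ≡ sumTo n g
  sumTo-cong zero    e = e 0 z≤n
  sumTo-cong (suc n) e = cong₂ _+_ (sumTo-cong n (λ i p → e i (m≤n⇒m≤1+n p))) (e (suc n) ≤-refl)

  sumTo-+ : ∀ n (f g : ℕ → ℤ) → sumTo n (λ i → f i + g i) ≡ sumTo n f + sumTo n g
  sumTo-+ zero    f g = refl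
  sumTo-+ (suc n) f g rewrite sumTo-+ n f g = interchange (sumTo n f) (sumTo n g) (f (suc n)) (g (suc n))
    where
    interchange : ∀ a b c d → (a + b) + (c + d) ≡ (a + c) + (b + d)
    interchange = solve-∀

  sumTo-- : ∀ n (f g : ℕ → ℤ) → sumTo n (λ i → f i - g i) ≡ sumTo n f - sumTo n g
  sumTo-- zero    f g = refl
  sumTo-- (suc n) f g rewrite sumTo-- n f g = interchange (sumTo n f) (sumTo n g) (f (suc n)) (g (suc n))
    where
    interchange : ∀ a b c d → (a - b) + (c - d) ≡ (a + c) - (b + d)
    interchange = solve-∀

  sumTo-*ˡ : ∀ n c (f : ℕ → ℤ) → sumTo n (λ i → c * f i) ≡ c * sumTo n f
  sumTo-*ˡ zero    c f = refl
  sumTo-*ˡ (suc n) c f rewrite sumTo-*ˡ n c f = sym (*-distribˡ-+ c (sumTo n f) (f (suc n)))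

  sumTo-0 : ∀ n {f : ℕ → ℤ} → (∀ i → i ≤ n → f i ≡ + 0) → sumTo n f ≡ + 0
  sumTo-0 n {f} e = trans (sumTo-cong n e) (zeros n)
    where
    zeros : ∀ n → sumTo n (λ _ → + 0) ≡ + 0
    zeros zero    = refl
    zeros (suc n) rewrite zeros n = refl

  sumTo-first : ∀ n (f : ℕ → ℤ) → sumTo (suc n) f ≡ f 0 + sumTo n (λ i → f (suc i))
  sumTo-first zero    f = refl
  sumTo-first (suc n) f rewrite sumTo-first n f = +-assoc (f 0) _ _

  sumTo-first-only : ∀ n (f : ℕ → ℤ) → (∀ i → f (suc i) ≡ + 0) → sumTo n f ≡ f 0
  sumTo-first-only zero    f e = refl
  sumTo-first-only (suc n) f e
    rewrite sumTo-first n f | sumTo-0 n {λ i → f (suc i)} (λ i _ → e i) = +-identityʳ (f 0)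

  sumTo-rev : ∀ n (f : ℕ → ℤ) → sumTo n f ≡ sumTo n (λ i → f (n ∸ i))
  sumTo-rev zero    f = refl
  sumTo-rev (suc n) f = begin
      sumTo n f + f (suc n)
    ≡⟨ cong (_+ f (suc n)) (sumTo-rev n f) ⟩
      sumTo n (λ i → f (n ∸ i)) + f (suc n)
    ≡⟨ +-comm _ (f (suc n)) ⟩
      f (suc n) + sumTo n (λ i → f (suc n ∸ suc i))
    ≡⟨ sym (sumTo-first n (λ i → f (suc n ∸ i))) ⟩
      sumTo (suc n) (λ i → f (suc n ∸ i))
    ∎
    where open ≡-Reasoning

  -- Coefficientwise equality, wrapped in a record so that the two series
  -- can be inferred from a proof.
  infix 4 _≋_
  record _≋_ (F G : Series) : Set where
    constructor mk
    field coeff : F ≈ G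
  open _≋_ public

  infixr 2 _⟨≈⟩_
  _⟨≈⟩_ : ∀ {F G H} → F ≋ G → G ≋ H → F ≋ H
  mk e ⟨≈⟩ mk f = mk λ n m → trans (e n m) (f n m)

  ≋-refl : ∀ F → F ≋ F
  ≋-refl F = mk λ _ _ → refl

  T : Series → Series
  T F zero    m = + 0
  T F (suc n) m = F n m

  X : Series → Series
  X F n zero    = + 0
  X F n (suc m) = F n m

  TX : Series → Series
  TX F = T (X F)

  sc : ℤ → Series → Series
  sc c F n m = c * F n m

  one : Series
  one = cst (+ 1)

  tS≋ : tS ≋ T one
  tS≋ = mk λ { zero m → refl ; (suc zero) zero → refl ; (suc zero) (suc m) → refl
             ; (suc (suc n)) zero → refl ; (suc (suc n)) (suc m) → refl }

  xS≋ : xS ≋ X one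
  xS≋ = mk λ { zero zero → refl ; (suc n) zero → refl ; zero (suc zero) → refl
             ; zero (suc (suc m)) → refl ; (suc n) (suc zero) → refl ; (suc n) (suc (suc m)) → refl }

  cst≋ : ∀ c → cst c ≋ sc c one
  cst≋ c = mk λ { zero zero → sym (*-identityʳ c) ; zero (suc m) → sym (*-zeroʳ c)
                ; (suc n) zero → sym (*-zeroʳ c) ; (suc n) (suc m) → sym (*-zeroʳ c) }

  T-cong : ∀ {F G} → F ≋ G → T F ≋ T G
  T-cong (mk e) = mk λ { zero m → refl ; (suc n) m → e n m }

  TX-cong : ∀ {F G} → F ≋ G → TX F ≋ TX G
  TX-cong (mk e) = mk λ { zero m → refl ; (suc n) zero → refl ; (suc n) (suc m) → e n m }

  sc-cong : ∀ c {F G} → F ≋ G → sc c F ≋ sc c G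
  sc-cong c (mk e) = mk λ n m → cong (c *_) (e n m)

  ⊕-cong : ∀ {F F' G G'} → F ≋ F' → G ≋ G' → F ⊕ G ≋ F' ⊕ G'
  ⊕-cong (mk e) (mk f) = mk λ n m → cong₂ _+_ (e n m) (f n m)

  ⊖-cong : ∀ {F F' G G'} → F ≋ F' → G ≋ G' → F ⊖ G ≋ F' ⊖ G'
  ⊖-cong (mk e) (mk f) = mk λ n m → cong₂ _-_ (e n m) (f n m)

  ⊗-cong : ∀ {F F' G G'} → F ≋ F' → G ≋ G' → F ⊗ G ≋ F' ⊗ G'
  ⊗-cong (mk e) (mk f) = mk λ n m →
    sumTo-cong n (λ i _ → sumTo-cong m (λ j _ → cong₂ _*_ (e i j) (f (n ∸ i) (m ∸ j))))

  ⊗-congˡ : ∀ {F F'} G → F ≋ F' → F ⊗ G ≋ F' ⊗ G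
  ⊗-congˡ G e = ⊗-cong e (≋-refl G)

  ⊗-congʳ : ∀ F {G G'} → G ≋ G' → F ⊗ G ≋ F ⊗ G'
  ⊗-congʳ F e = ⊗-cong (≋-refl F) e

  ⊗-comm : ∀ F G → F ⊗ G ≋ G ⊗ F
  ⊗-comm F G = mk λ n m → begin
      sumTo n (λ i → sumTo m (λ j → F i j * G (n ∸ i) (m ∸ j)))
    ≡⟨ sumTo-rev n _ ⟩
      sumTo n (λ i → sumTo m (λ j → F (n ∸ i) j * G (n ∸ (n ∸ i)) (m ∸ j)))
    ≡⟨ sumTo-cong n (λ i _ → sumTo-rev m _) ⟩
      sumTo n (λ i → sumTo m (λ j → F (n ∸ i) (m ∸ j) * G (n ∸ (n ∸ i)) (m ∸ (m ∸ j))))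
    ≡⟨ sumTo-cong n (λ i p → sumTo-cong m (λ j q →
          trans (*-comm (F (n ∸ i) (m ∸ j)) (G (n ∸ (n ∸ i)) (m ∸ (m ∸ j))))
                (cong₂ (λ a b → G a b * F (n ∸ i) (m ∸ j)) (m∸[m∸n]≡n p) (m∸[m∸n]≡n q)))) ⟩
      sumTo n (λ i → sumTo m (λ j → G i j * F (n ∸ i) (m ∸ j)))
    ∎
    where open ≡-Reasoning

  ⊗-distrib-⊕ : ∀ F G H → F ⊗ (G ⊕ H) ≋ F ⊗ G ⊕ F ⊗ H
  ⊗-distrib-⊕ F G H = mk λ n m →
    trans (sumTo-cong n (λ i _ → trans (sumTo-cong m (λ j _ → *-distribˡ-+ (F i j) _ _)) (sumTo-+ m _ _)))
          (sumTo-+ n _ _)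

  ⊗-distrib-⊖ : ∀ F G H → F ⊗ (G ⊖ H) ≋ F ⊗ G ⊖ F ⊗ H
  ⊗-distrib-⊖ F G H = mk λ n m →
    trans (sumTo-cong n (λ i _ → trans (sumTo-cong m (λ j _ → distrib (F i j) _ _)) (sumTo-- m _ _)))
          (sumTo-- n _ _)
    where
    distrib : ∀ a b c → a * (b - c) ≡ a * b - a * c
    distrib = solve-∀

  ⊗-identityˡ : ∀ F → one ⊗ F ≋ F
  ⊗-identityˡ F = mk λ n m →
    trans (sumTo-first-only n _ (λ i → sumTo-0 m (λ j _ → refl)))
          (trans (sumTo-first-only m _ (λ j → refl)) (*-identityˡ (F n m)))

  ⊗-identityʳ : ∀ F → F ⊗ one ≋ F
  ⊗-identityʳ F = ⊗-comm F one ⟨≈⟩ ⊗-identityˡ F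

  T-⊗ : ∀ F G → T F ⊗ G ≋ T (F ⊗ G)
  T-⊗ F G = mk λ
    { zero m → sumTo-0 m (λ j _ → refl)
    ; (suc n) m → let rest = sumTo n (λ i → sumTo m (λ j → F i j * G (n ∸ i) (m ∸ j))) in
        trans (sumTo-first n _) (trans (cong (_+ rest) (sumTo-0 m (λ j _ → refl))) (+-identityˡ rest)) }

  X-⊗ : ∀ F G → X F ⊗ G ≋ X (F ⊗ G)
  X-⊗ F G = mk λ
    { n zero → sumTo-0 n (λ i _ → refl)
    ; n (suc m) → sumTo-cong n (λ i _ → trans (sumTo-first m _)
        (+-identityˡ (sumTo m (λ j → F i j * G (n ∸ i) (m ∸ j))))) }

  TX-⊗ : ∀ F G → TX F ⊗ G ≋ TX (F ⊗ G)
  TX-⊗ F G = T-⊗ (X F) G ⟨≈⟩ T-cong (X-⊗ F G)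

  sc-⊗ : ∀ c F G → sc c F ⊗ G ≋ sc c (F ⊗ G)
  sc-⊗ c F G = mk λ n m →
    trans (sumTo-cong n (λ i _ → trans (sumTo-cong m (λ j _ → *-assoc c _ _)) (sumTo-*ˡ m c _)))
          (sumTo-*ˡ n c _)

  TX-⊕ : ∀ F G → TX (F ⊕ G) ≋ TX F ⊕ TX G
  TX-⊕ F G = mk λ { zero m → refl ; (suc n) zero → refl ; (suc n) (suc m) → refl }

  TX-⊖ : ∀ F G → TX (F ⊖ G) ≋ TX F ⊖ TX G
  TX-⊖ F G = mk λ { zero m → refl ; (suc n) zero → refl ; (suc n) (suc m) → refl }

  TX-sc : ∀ c F → TX (sc c F) ≋ sc c (TX F)
  TX-sc c F = mk λ { zero m → sym (*-zeroʳ c) ; (suc n) zero → sym (*-zeroʳ c) ; (suc n) (suc m) → refl }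

-- Blocks u of length i < k never earn the bonus and are counted by Q(i, ·),
-- which equals the coefficient C_i t^i of S (catalan-prefix); longer blocks
-- earn the factor x and are counted by Q - S, as S vanishes there.
module FunctionalEquation where

  open import Defs
  open NatSums using (ssum; ssum-cong)
  open BoolFacts using (<ᵇ-true; <ᵇ-false; ≤ᵇ-true; ≤ᵇ-false)
  open DecompositionRecurrence using (qcount-rec; qcount-short; blockCount; conv; conv⁺)
  open Catalan using (catalan-recurrence)
  open PowerSeries
  open import Data.Nat as ℕ using (ℕ; zero; suc; _∸_; _≤_; _<_; _≤?_)
  open import Data.Nat.Properties using (<-≤-trans; <⇒≤; ≰⇒>)
  open import Data.Integer using (ℤ; +_; _+_; _*_; _-_)
  open import Data.Integer.Properties using (pos-+; pos-*; +-identityˡ; +-identityʳ; +-inverseʳ)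
  open import Relation.Binary.PropositionalEquality
  open import Relation.Nullary using (yes; no)

  ssum-embed : ∀ n f → + ssum (suc n) f ≡ sumTo n (λ i → + f i)
  ssum-embed zero    f = refl
  ssum-embed (suc n) f = trans (pos-+ (ssum (suc n) f) (f (suc n))) (cong (_+ + f (suc n)) (ssum-embed n f))

  conv-embed : ∀ k a b M → + conv k a b M ≡ sumTo M (λ j → Q k a j * Q k b (M ∸ j))
  conv-embed k a b M =
    trans (ssum-embed M _) (sumTo-cong M (λ j _ → pos-* (qcount k a j) (qcount k b (M ∸ j))))

  module _ (k : ℕ) where

    catalan-prefix : ∀ i → i < k → qcount k i 0 ≡ catalan i
    catalan-prefix = catalan-recurrence (λ i → qcount k i 0) k refl rec
      where
      rec : ∀ n → suc n < k → qcount k (suc n) 0 ≡ ssum (suc n) (λ i → qcount k i 0 ℕ.* qcount k (n ∸ i) 0)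
      rec n lt = trans (qcount-rec k n 0) (ssum-cong (suc n) (λ i i< → short i (<-≤-trans i< (<⇒≤ lt))))
        where
        short : ∀ i → i < k → blockCount k n 0 i ≡ qcount k i 0 ℕ.* qcount k (n ∸ i) 0
        short i lt rewrite ≤ᵇ-false lt = refl

    Q≡S-below : ∀ i j → i < k → Q k i j ≡ Sk k i j
    Q≡S-below i zero    lt rewrite <ᵇ-true lt = cong +_ (catalan-prefix i lt)
    Q≡S-below i (suc j) lt = cong +_ (qcount-short k i j (<⇒≤ lt))

    S≡0-above : ∀ i j → k ≤ i → Sk k i j ≡ + 0
    S≡0-above i zero    le rewrite <ᵇ-false le = refl
    S≡0-above i (suc j) le = refl

    -- the i-th terms of (S ⊗ Q)(n, m) and of (X ((Q ⊖ S) ⊗ Q))(n, m)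
    lowPart : ℕ → ℕ → ℕ → ℤ
    lowPart n m i = sumTo m (λ j → Sk k i j * Q k (n ∸ i) (m ∸ j))

    highPart : ℕ → ℕ → ℕ → ℤ
    highPart n zero    i = + 0
    highPart n (suc M) i = sumTo M (λ j → (Q k i j - Sk k i j) * Q k (n ∸ i) (M ∸ j))

    block-split : ∀ n m i → + blockCount k n m i ≡ lowPart n m i + highPart n m i
    block-split n m i with k ≤? i
    ... | yes le rewrite ≤ᵇ-true le =
      trans (long m) (sym (trans (cong (_+ highPart n m i) low≡0) (+-identityˡ (highPart n m i))))
      where
      low≡0 : lowPart n m i ≡ + 0
      low≡0 = sumTo-0 m (λ j _ → cong (_* Q k (n ∸ i) (m ∸ j)) (S≡0-above i j le))
      long : ∀ m → + conv⁺ k i (n ∸ i) m ≡ highPart n m i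
      long zero    = refl
      long (suc M) = trans (conv-embed k i (n ∸ i) M) (sumTo-cong M (λ j _ →
        cong (_* Q k (n ∸ i) (M ∸ j)) (sym (trans (cong (λ s → Q k i j - s) (S≡0-above i j le)) (+-identityʳ (Q k i j))))))
    ... | no nle rewrite ≤ᵇ-false (≰⇒> nle) =
      trans (conv-embed k i (n ∸ i) m)
            (trans (sumTo-cong m (λ j _ → cong (_* Q k (n ∸ i) (m ∸ j)) (Q≡S-below i j (≰⇒> nle))))
                   (sym (trans (cong (λ h → lowPart n m i + h) (high≡0 m)) (+-identityʳ (lowPart n m i)))))
      where
      high≡0 : ∀ m → highPart n m i ≡ + 0
      high≡0 zero    = refl
      high≡0 (suc M) = sumTo-0 M (λ j _ →
        cong (_* Q k (n ∸ i) (M ∸ j)) (trans (cong (_- Sk k i j) (Q≡S-below i j (≰⇒> nle))) (+-inverseʳ (Sk k i j))))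

    high-sum : ∀ n m → sumTo n (λ i → highPart n m i) ≡ TX ((Q k ⊖ Sk k) ⊗ Q k) (suc n) m
    high-sum n zero    = sumTo-0 n (λ _ _ → refl)
    high-sum n (suc M) = refl

    functional-equation : Q k ≋ one ⊕ T (Sk k ⊗ Q k) ⊕ TX ((Q k ⊖ Sk k) ⊗ Q k)
    functional-equation = mk coefficients
      where
      coefficients : ∀ n m → Q k n m ≡ (one ⊕ T (Sk k ⊗ Q k) ⊕ TX ((Q k ⊖ Sk k) ⊗ Q k)) n m
      coefficients zero    zero    = refl
      coefficients zero    (suc m) = refl
      coefficients (suc n) m = begin
          + qcount k (suc n) m
        ≡⟨ cong +_ (qcount-rec k n m) ⟩
          + ssum (suc n) (blockCount k n m)
        ≡⟨ ssum-embed n (blockCount k n m) ⟩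
          sumTo n (λ i → + blockCount k n m i)
        ≡⟨ sumTo-cong n (λ i _ → block-split n m i) ⟩
          sumTo n (λ i → lowPart n m i + highPart n m i)
        ≡⟨ sumTo-+ n _ _ ⟩
          (Sk k ⊗ Q k) n m + sumTo n (highPart n m)
        ≡⟨ cong₂ _+_ (sym (+-identityˡ ((Sk k ⊗ Q k) n m))) (high-sum n m) ⟩
          + 0 + (Sk k ⊗ Q k) n m + TX ((Q k ⊖ Sk k) ⊗ Q k) (suc n) m
        ∎
        where open ≡-Reasoning

-- With N = 1 + (tx - t) S the equation says Q N = 1 + tx Q²,
-- so G = N - 2txQ satisfies G² = N² - 4tx and Q (N + G) = 2; G is the
-- square root in the closed forms of Q.
module QuadraticSolution where

  open import Defs
  open PowerSeries
  open import Data.Nat using (zero; suc; _∸_)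
  open import Data.Integer using (+_; _+_; _*_; _-_)
  open import Data.Integer.Properties using (*-zeroʳ)
  open import Data.Integer.Tactic.RingSolver using (solve-∀)
  open import Relation.Binary.PropositionalEquality


  module Solution (S Q : Series) (functional-equation : Q ≋ one ⊕ T (S ⊗ Q) ⊕ TX ((Q ⊖ S) ⊗ Q)) where

    N : Series
    N = cst (+ 1) ⊕ (tS ⊗ xS ⊖ tS) ⊗ S

    P : Series
    P = TX (Q ⊗ Q)

    M : Series
    M = cst (+ 2) ⊗ tS ⊗ xS ⊗ Q

    G : Series
    G = N ⊖ M

    tS⊗ : ∀ F → tS ⊗ F ≋ T F
    tS⊗ F = ⊗-congˡ F tS≋ ⟨≈⟩ T-⊗ one F ⟨≈⟩ T-cong (⊗-identityˡ F)

    tS⊗xS : tS ⊗ xS ≋ TX one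
    tS⊗xS = tS⊗ xS ⟨≈⟩ T-cong xS≋

    ctx : ∀ c → cst c ⊗ tS ⊗ xS ≋ sc c (TX one)
    ctx c = ⊗-congˡ xS (⊗-congˡ tS (cst≋ c) ⟨≈⟩ sc-⊗ c one tS ⟨≈⟩ sc-cong c (⊗-identityˡ tS))
            ⟨≈⟩ sc-⊗ c tS xS ⟨≈⟩ sc-cong c tS⊗xS

    N≋ : N ≋ one ⊕ (TX S ⊖ T S)
    N≋ = ⊕-cong (≋-refl one)
           ( ⊗-comm (tS ⊗ xS ⊖ tS) S
           ⟨≈⟩ ⊗-distrib-⊖ S (tS ⊗ xS) tS
           ⟨≈⟩ ⊖-cong (⊗-congʳ S tS⊗xS ⟨≈⟩ ⊗-comm S (TX one) ⟨≈⟩ TX-⊗ one S ⟨≈⟩ TX-cong (⊗-identityˡ S))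
                      (⊗-comm S tS ⟨≈⟩ tS⊗ S))

    Q⊗N : Q ⊗ N ≋ Q ⊕ (TX (S ⊗ Q) ⊖ T (S ⊗ Q))
    Q⊗N = ⊗-congʳ Q N≋ ⟨≈⟩ ⊗-distrib-⊕ Q one (TX S ⊖ T S) ⟨≈⟩
          ⊕-cong (⊗-identityʳ Q)
                 (⊗-distrib-⊖ Q (TX S) (T S) ⟨≈⟩
                  ⊖-cong (⊗-comm Q (TX S) ⟨≈⟩ TX-⊗ S Q) (⊗-comm Q (T S) ⟨≈⟩ T-⊗ S Q))

    quadratic : Q ⊗ N ≋ one ⊕ P
    quadratic =
      Q⊗N ⟨≈⟩ ⊕-cong (functional-equation ⟨≈⟩ ⊕-cong (≋-refl (one ⊕ T (S ⊗ Q))) expand-tx)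
                   (≋-refl (TX (S ⊗ Q) ⊖ T (S ⊗ Q))) ⟨≈⟩ cancel
      where
      expand-tx : TX ((Q ⊖ S) ⊗ Q) ≋ P ⊖ TX (S ⊗ Q)
      expand-tx = TX-cong (⊗-comm (Q ⊖ S) Q ⟨≈⟩ ⊗-distrib-⊖ Q Q S ⟨≈⟩ ⊖-cong (≋-refl (Q ⊗ Q)) (⊗-comm Q S))
                  ⟨≈⟩ TX-⊖ (Q ⊗ Q) (S ⊗ Q)
      identity : ∀ o a b c → ((o + a) + (b - c)) + (c - a) ≡ o + b
      identity = solve-∀
      cancel : ((one ⊕ T (S ⊗ Q)) ⊕ (P ⊖ TX (S ⊗ Q))) ⊕ (TX (S ⊗ Q) ⊖ T (S ⊗ Q)) ≋ one ⊕ P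
      cancel = mk λ n m → identity (one n m) (T (S ⊗ Q) n m) (P n m) (TX (S ⊗ Q) n m)

    M≋ : M ≋ sc (+ 2) (TX Q)
    M≋ = ⊗-congˡ Q (ctx (+ 2)) ⟨≈⟩ sc-⊗ (+ 2) (TX one) Q ⟨≈⟩ sc-cong (+ 2) (TX-⊗ one Q ⟨≈⟩ TX-cong (⊗-identityˡ Q))

    M⊗Q : M ⊗ Q ≋ sc (+ 2) P
    M⊗Q = ⊗-congˡ Q M≋ ⟨≈⟩ sc-⊗ (+ 2) (TX Q) Q ⟨≈⟩ sc-cong (+ 2) (TX-⊗ Q Q)

    M⊗N : M ⊗ N ≋ sc (+ 2) (TX one ⊕ TX P)
    M⊗N = ⊗-congˡ N M≋ ⟨≈⟩ sc-⊗ (+ 2) (TX Q) N ⟨≈⟩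
          sc-cong (+ 2) (TX-⊗ Q N ⟨≈⟩ TX-cong quadratic ⟨≈⟩ TX-⊕ one P)

    M⊗M : M ⊗ M ≋ sc (+ 2) (sc (+ 2) (TX P))
    M⊗M = ⊗-congˡ M M≋ ⟨≈⟩ sc-⊗ (+ 2) (TX Q) M ⟨≈⟩
          sc-cong (+ 2) (TX-⊗ Q M ⟨≈⟩ TX-cong (⊗-comm Q M ⟨≈⟩ M⊗Q) ⟨≈⟩ TX-sc (+ 2) P)

    G-constant : G 0 0 ≡ + 1
    G-constant = trans (cong (N 0 0 -_) (coeff M≋ 0 0)) (cong (_- + 0) (coeff N≋ 0 0))

    M≋N⊖G : M ≋ N ⊖ G
    M≋N⊖G = mk λ n m → identity (N n m) (M n m)
      where
      identity : ∀ a b → b ≡ a - (a - b)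
      identity = solve-∀

    -- G² = N² - 2MN + M² = N² - 4tx, using MN = 2tx + 2tx·txQ² and M² = 4tx·txQ²
    G-square : G ⊗ G ≋ N ⊗ N ⊖ cst (+ 4) ⊗ tS ⊗ xS
    G-square = ⊗-distrib-⊖ G N M ⟨≈⟩
               ⊖-cong (⊗-comm G N ⟨≈⟩ ⊗-distrib-⊖ N N M) (⊗-comm G M ⟨≈⟩ ⊗-distrib-⊖ M N M) ⟨≈⟩
               ⊖-cong (⊖-cong (≋-refl (N ⊗ N)) (⊗-comm N M ⟨≈⟩ M⊗N)) (⊖-cong M⊗N M⊗M) ⟨≈⟩
               collect
      where
      identity : ∀ a r p → (a - (+ 2) * (r + p)) - ((+ 2) * (r + p) - (+ 2) * ((+ 2) * p)) ≡ a - (+ 4) * r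
      identity = solve-∀
      collect : (N ⊗ N ⊖ sc (+ 2) (TX one ⊕ TX P)) ⊖ (sc (+ 2) (TX one ⊕ TX P) ⊖ sc (+ 2) (sc (+ 2) (TX P)))
                ≋ N ⊗ N ⊖ cst (+ 4) ⊗ tS ⊗ xS
      collect = mk λ n m → trans (identity ((N ⊗ N) n m) (TX one n m) (TX P n m))
                                 (cong ((N ⊗ N) n m -_) (sym (coeff (ctx (+ 4)) n m)))

    -- Q (N + G) = 2 QN - QM = 2 (1 + txQ²) - 2txQ² = 2
    Q-closed-form : Q ⊗ (N ⊕ G) ≋ cst (+ 2)
    Q-closed-form = ⊗-distrib-⊕ Q N G ⟨≈⟩
                    ⊕-cong quadratic (⊗-distrib-⊖ Q N M ⟨≈⟩ ⊖-cong quadratic (⊗-comm Q M ⟨≈⟩ M⊗Q)) ⟨≈⟩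
                    collect
      where
      identity : ∀ o p → (o + p) + ((o + p) - (+ 2) * p) ≡ (+ 2) * o
      identity = solve-∀
      collect : (one ⊕ P) ⊕ ((one ⊕ P) ⊖ sc (+ 2) P) ≋ cst (+ 2)
      collect = mk λ n m → trans (identity (one n m) (P n m)) (sym (coeff (cst≋ (+ 2)) n m))

    -- Setting x = 0.  If S does not involve x, then N(t, 0) = 1 - tS, and the
    -- x⁰-part Q₀ of Q satisfies Q₀ (1 - tS) = 1 (the x⁰-part of QN = 1 + txQ²).
    module AtXZero (S-x-free : ∀ n m → S n (suc m) ≡ + 0)
                   (Q₀ : Series) (Q₀-x⁰ : ∀ n → Q₀ n 0 ≡ Q n 0) (Q₀-x⁺ : ∀ n m → Q₀ n (suc m) ≡ + 0) where

      E : Series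
      E = one ⊖ tS ⊗ S

      E-x⁺ : ∀ p m → E p (suc m) ≡ + 0
      E-x⁺ p m = trans (cong (one p (suc m) -_) (coeff (tS⊗ S) p (suc m))) (vanish p)
        where
        vanish : ∀ p → one p (suc m) - T S p (suc m) ≡ + 0
        vanish zero    = refl
        vanish (suc p) = cong (+ 0 -_) (S-x-free p m)

      N≡E-x⁰ : ∀ p → N p 0 ≡ E p 0
      N≡E-x⁰ p = trans (coeff N≋ p 0) (trans (drop-TX p) (cong (one p 0 -_) (sym (coeff (tS⊗ S) p 0))))
        where
        identity : ∀ o t → o + (+ 0 - t) ≡ o - t
        identity = solve-∀
        drop-TX : ∀ p → one p 0 + (TX S p 0 - T S p 0) ≡ one p 0 - T S p 0
        drop-TX zero    = refl
        drop-TX (suc p) = identity (one (suc p) 0) (T S (suc p) 0)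

      Q₀-closed-form : Q₀ ⊗ E ≋ one
      Q₀-closed-form = mk λ n m →
        trans (sumTo-cong n (λ i _ → sumTo-first-only m _ (λ j → cong (_* E (n ∸ i) (m ∸ suc j)) (Q₀-x⁺ i j)))) (x⁰-part n m)
        where
        x⁰-part : ∀ n m → sumTo n (λ i → Q₀ i 0 * E (n ∸ i) (m ∸ 0)) ≡ one n m
        x⁰-part n (suc m) = trans (sumTo-0 n (λ i _ → trans (cong (Q₀ i 0 *_) (E-x⁺ (n ∸ i) m)) (*-zeroʳ (Q₀ i 0))))
                                  (zero-coefficient n)
          where
          zero-coefficient : ∀ n → + 0 ≡ one n (suc m)
          zero-coefficient zero    = refl
          zero-coefficient (suc n) = refl
        x⁰-part n zero = trans (sumTo-cong n (λ i _ → cong₂ _*_ (Q₀-x⁰ i) (sym (N≡E-x⁰ (n ∸ i)))))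
                               (trans (coeff quadratic n 0) (no-tx n))
          where
          no-tx : ∀ n → one n 0 + P n 0 ≡ one n 0
          no-tx zero    = refl
          no-tx (suc n) = refl

open import Defs
open import Data.Nat using (ℕ; _≤_)
open import Data.Integer using (+_)
open import Data.Product using (Σ; _×_; _,_)
open import Relation.Binary.PropositionalEquality using (_≡_; refl)
open PowerSeries using (coeff)

-- G is the square root of the discriminant (1 + (tx - t) S_k)² - 4tx with
-- constant term 1.  The second and third components give the first closed
-- form (2tx Q = N - G), the fourth the second (Q (N + G) = 2), and the last
-- Q(t, 0) = 1 / (1 - t S_k(t)).
theorem14 : (k : ℕ) → 1 ≤ k →
    Σ Series (λ G →
    (G 0 0 ≡ + 1) × (G ⊗ G ≈ Dk k) ×
    (cst (+ 2) ⊗ tS ⊗ xS ⊗ Q k ≈ Nk k ⊖ G) ×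
    (Q k ⊗ (Nk k ⊕ G) ≈ cst (+ 2)) ×
    (Q0 k ⊗ (cst (+ 1) ⊖ tS ⊗ Sk k) ≈ cst (+ 1)))
theorem14 k _ =
  G , G-constant , coeff G-square , coeff M≋N⊖G , coeff Q-closed-form ,
  coeff (AtXZero.Q₀-closed-form (λ _ _ → refl) (Q0 k) (λ _ → refl) (λ _ _ → refl))
  where open QuadraticSolution.Solution (Sk k) (Q k) (FunctionalEquation.functional-equation k)
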